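{- Let $f$ be the $\mathbb{Q}$-linear map $\mathbb{Q}W^0\to\mathbb{Q}[[q]]$ defined below. If $w$ lies in the $\mathbb{Q}$-span of admissible words in the five letters $e_{AB},e_{AC},e_{BC},e_{BD},e_{CD}$ (i.e. $w\in\mathbb{Q}\langle e_{AB},e_{AC},e_{BC},e_{BD},e_{CD}\rangle\cap\mathbb{Q}W^0$), then $f(w)=f(\tau(w))$.
   Context: $W$ is the set of finite words in the six formal letters $e_{AB},e_{AC},e_{AD},e_{BC},e_{BD},e_{CD}$; a letter $e_{uv}$ has first entry $u$ and second entry $v$. A word is admissible if it does not begin with $e_{AB},e_{AC},e_{AD}$ and does not end with $e_{AD},e_{BD},e_{CD}$; $W^0$ is the set of admissible words and $\mathbb{Q}W^0$ its $\mathbb{Q}$-span. $\tau$ is the anti-automorphism of words (extended linearly) with $\tau(e_{AB})=e_{CD}$, $\tau(e_{AC})=e_{BD}$, $\tau(e_{AD})=e_{AD}$, $\tau(e_{BC})=e_{BC}$, $\tau(e_{BD})=e_{AC}$, $\tau(e_{CD})=e_{AB}$. For $w=e_{u_1v_1}\cdots e_{u_kv_k}\in W^0$ set $d_j:=\#\{h\geq j\mid u_hv_h\in\{AB,AC,BC\}\}$ (admissibility gives $d_j\geq1$) and \[ f(w):=\sum_{n_1\geq n_2\geq\cdots\geq n_k\geq0}\prod_{j=1}^k\bigl(\varphi_j(u_j)-\varphi_j(v_j)\bigr)\in\mathbb{Q}[[q]], \] where $\varphi_j(A)=1$, $\varphi_j(B)=\varphi_j(C)=0$, $\varphi_j(D)=\dfrac{q^{n_j}}{q^{n_j}-q^{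 -d_j}}=-\dfrac{q^{n_j+d_j}}{1-q^{n_j+d_j}}$ (the series converges $q$-adically; $f(\text{empty word})=1$). Equivalently $f(w)=I_q(0;[u_1^{(1)},v_1^{(1)}],\dots,[u_k^{(k)},v_k^{(k)}];1)$ with $t_j=q^{n_j}$, $A^{(j)}=0$, $B^{(j)}=C^{(j)}=\infty$, $D^{(j)}=q^{ -d_j}$; this is the specialization $A=0$, $B=C=\infty$, $D=1$ of the paper's functional $L_q$. Extend $f$ $\mathbb{Q}$-linearly. -}

module Defs where

open import Data.Nat using (ℕ; zero; suc; _+_; _∸_; _≤_)
open import Data.Nat.Divisibility using (_∣?_)
open import Data.Rational using (ℚ; 0ℚ; 1ℚ; -_) renaming (_+_ to _+q_; _*_ to _*q_; _-_ to _-q_)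
open import Data.List using (List; []; _∷_; map; reverse)
open import Data.Product using (_×_; _,_; ∃-syntax; proj₂)
open import Data.Bool using (Bool; true; false; if_then_else_)
open import Data.Empty using (⊥)
open import Data.Unit using (⊤)
open import Relation.Nullary.Decidable using (does)
open import Relation.Binary.PropositionalEquality using (_≡_)

data Vtx : Set where
  A B C D : Vtx

data Letter : Set where
  eAB eAC eAD eBC eBD eCD : Letter

first : Letter → Vtx
first eAB = A
first eAC = A
first eAD = A
first eBC = B
first eBD = B
first eCD = C

second : Letter → Vtx
second eAB = B
second eAC = C
second eAD = D
second eBC = C
second eBD = D
second eCD = D

Word : Set
Word = List Letter

badFirst : Letter → Set
badFirst l with first l
... | A = ⊤
... | _ = ⊥

badLast : Letter → Set
badLast l with second l
... | D = ⊤
... | _ = ⊥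

NotBeginBad : Word → Set
NotBeginBad []      = ⊤
NotBeginBad (l ∷ _) = badFirst l → ⊥

NotEndBad : Word → Set
NotEndBad []          = ⊤
NotEndBad (l ∷ [])    = badLast l → ⊥
NotEndBad (_ ∷ m ∷ w) = NotEndBad (m ∷ w)

Admissible : Word → Set
Admissible w = NotBeginBad w × NotEndBad w

NoAD : Word → Set
NoAD []        = ⊤
NoAD (eAD ∷ w) = ⊥
NoAD (_ ∷ w)   = NoAD w

τl : Letter → Letter
τl eAB = eCD
τl eAC = eBD
τl eAD = eAD
τl eBC = eBC
τl eBD = eAC
τl eCD = eAB

τ : Word → Word
τ w = reverse (map τl w)

-- elements of ℚW : finite formal ℚ-linear combinations of words
LinComb : Set
LinComb = List (ℚ × Word)

τLin : LinComb → LinComb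
τLin = map (λ { (c , w) → (c , τ w) })

Series : Set
Series = ℕ → ℚ

sumTo : ℕ → (ℕ → ℚ) → ℚ
sumTo zero    g = g 0
sumTo (suc n) g = sumTo n g +q g (suc n)

cst : ℚ → Series
cst c zero    = c
cst c (suc _) = 0ℚ

_⊕_ : Series → Series → Series
(a ⊕ b) i = a i +q b i

_⊖_ : Series → Series → Series
(a ⊖ b) i = a i -q b i

_⊛_ : Series → Series → Series
(a ⊛ b) n = sumTo n (λ i → a i *q b (n ∸ i))

scale : ℚ → Series → Series
scale c a i = c *q a i

-- the series  - q^m / (1 - q^m) = - Σ_{r ≥ 1} q^{r m}
negGeomTail : ℕ → Series
negGeomTail m zero    = 0ℚ
negGeomTail m (suc i) = if does (m ∣? suc i) then - 1ℚ else 0ℚ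

-- φ_j(v) with n = n_j, d = d_j ;  φ_j(D) = q^n/(q^n - q^{-d}) = -q^{n+d}/(1-q^{n+d})
φ : Vtx → ℕ → ℕ → Series
φ A n d = cst 1ℚ
φ B n d = cst 0ℚ
φ C n d = cst 0ℚ
φ D n d = negGeomTail (n + d)

factor : Letter → ℕ → ℕ → Series
factor l n d = φ (first l) n d ⊖ φ (second l) n d

isABC : Letter → ℕ
isABC eAB = 1
isABC eAC = 1
isABC eBC = 1
isABC _   = 0

dCount : Word → ℕ
dCount []      = 0
dCount (l ∷ w) = isABC l + dCount w

-- partial sum of the defining series of f(w) over M ≥ n_1 ≥ n_2 ≥ ... ≥ n_k ≥ 0
partial : ℕ → Word → Series
partial M []        = cst 1ℚ
partial M (l ∷ w)   =
  λ i → sumTo M (λ n → (factor l n (dCount (l ∷ w)) ⊛ partial n w) i)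

partialLin : ℕ → LinComb → Series
partialLin M []            = cst 0ℚ
partialLin M ((c , w) ∷ x) = scale c (partial M w) ⊕ partialLin M x

-- q-adic equality of limits: every coefficient of the partial sums
-- eventually agrees (M → ∞)
SameLimit : (ℕ → Series) → (ℕ → Series) → Set
SameLimit s t = ∀ N → ∃[ M₀ ] (∀ M → M₀ ≤ M → s M N ≡ t M N)

fEq : LinComb → LinComb → Set
fEq x y = SameLimit (λ M → partialLin M x) (λ M → partialLin M y)

-- Words containing e_BC contribute nothing, since φ(B) = φ(C). In every other word each
-- letter is of kind X (e_AB, e_AC: factor 1) or Y (e_BD, e_CD: factor q^{n+d}/(1 − q^{n+d}),
-- d the number of X's from that letter on), admissibility says the word is Y v X, and τ
-- reverses the word and swaps X with Y.
--
-- Let chain u R be the sum over index chains 0 = R₀ ≤ R₁ ≤ … ≤ R_k = R with one step per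
-- letter of u (the head of u taking the last step), where a Y step is strict and weighs
-- 1/(1 − q^{R_i}), and an X step stays put and weighs q^{R_i}/(1 − q^{R_i}). Moving the
-- letters of w one at a time into a chain through the interpolating sum bridge₁ (each move
-- is a geometric-series identity) gives f(w) = Σ_R chain (reverse w) R. Moving them through
-- bridge₂, which pairs two chains by the kernel q^{RT} (q;q)_R (q;q)_T / (q;q)_{R+T}
-- (symmetric in R, T and telescoping in R), gives Σ_R chain (reverse w) R = Σ_R chain (swap w) R.
-- Since reverse (τ w) = swap w, f(w) = f(τ w). Everything is computed modulo q^{N+1}, where
-- all sums may be cut off at N.

{-# OPTIONS --safe #-}
module Submission where

open import Algebra.Bundles using (CommutativeMonoid; CommutativeRing)
open import Algebra.Structures using (IsCommutativeRing)
open import Algebra.Solver.Ring.AlmostCommutativeRing using (fromCommutativeRing; _-Raw-AlmostCommutative⟶_)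
import Algebra.Solver.Ring as RingSolver
open import Data.Bool using (Bool; true; false; if_then_else_)
open import Data.Empty using (⊥-elim)
open import Data.List using (List; []; _∷_; _++_; [_]; map; reverse; _ʳ++_)
import Data.List.Properties as List
open import Data.List.Relation.Binary.Pointwise using (Pointwise; []; _∷_)
import Data.List.Relation.Binary.Pointwise as Pointwise
open import Data.List.Relation.Unary.All using (All; []; _∷_)
open import Data.List.Relation.Unary.Any using (Any; here; there)
import Data.List.Relation.Unary.Any as Any
import Data.List.Relation.Unary.Any.Properties as Any
open import Data.Maybe using (Maybe; just; nothing)
open import Data.Nat using (ℕ; zero; suc; pred; _+_; _*_; _∸_; _≤_; _<_; z≤n; s≤s; _<ᵇ_; _≤ᵇ_)
open import Data.Nat.Divisibility using (_∣_; _∣?_; ∣-refl; 0∣⇒≡0; ∣m+n∣m⇒∣n; ∣m∣n⇒∣m+n; ∣⇒≤)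
import Data.Nat.Properties as ℕ
open import Data.Product using (_×_; _,_; proj₂; ∃-syntax)
open import Data.Rational using (ℚ; 0ℚ; 1ℚ; -_) renaming (_+_ to _+q_; _*_ to _*q_)
import Data.Rational.Properties as ℚ
open import Algebra.Properties.CommutativeSemigroup
  (CommutativeMonoid.commutativeSemigroup ℚ.+-0-commutativeMonoid) using (interchange)
open import Data.Sum using (_⊎_; inj₁; inj₂)
open import Data.Unit using (tt)
open import Function using (_∘_)
open import Relation.Binary.Definitions using (tri<; tri≈; tri>)
open import Relation.Binary.PropositionalEquality
  using (_≡_; _≢_; refl; sym; trans; cong; cong₂; subst; _≗_; module ≡-Reasoning)
open import Relation.Nullary using (yes; no; does)

open import Defs

sumTo-cong : ∀ n {f g : ℕ → ℚ} → (∀ i → i ≤ n → f i ≡ g i) → sumTo n f ≡ sumTo n g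
sumTo-cong zero    f≡g = f≡g 0 z≤n
sumTo-cong (suc n) f≡g =
  cong₂ _+q_ (sumTo-cong n (λ i i≤n → f≡g i (ℕ.m≤n⇒m≤1+n i≤n))) (f≡g (suc n) ℕ.≤-refl)

sumTo-zero : ∀ n (f : ℕ → ℚ) → (∀ i → i ≤ n → f i ≡ 0ℚ) → sumTo n f ≡ 0ℚ
sumTo-zero zero    f f≡0 = f≡0 0 z≤n
sumTo-zero (suc n) f f≡0 =
  cong₂ _+q_ (sumTo-zero n f (λ i i≤n → f≡0 i (ℕ.m≤n⇒m≤1+n i≤n))) (f≡0 (suc n) ℕ.≤-refl)

sumTo-+ : ∀ n (f g : ℕ → ℚ) → sumTo n (λ i → f i +q g i) ≡ sumTo n f +q sumTo n g
sumTo-+ zero    f g = refl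
sumTo-+ (suc n) f g = trans (cong (_+q (f (suc n) +q g (suc n))) (sumTo-+ n f g))
                            (interchange (sumTo n f) (sumTo n g) (f (suc n)) (g (suc n)))

sumTo-*ˡ : ∀ n c (f : ℕ → ℚ) → c *q sumTo n f ≡ sumTo n (λ i → c *q f i)
sumTo-*ˡ zero    c f = refl
sumTo-*ˡ (suc n) c f = trans (ℚ.*-distribˡ-+ c (sumTo n f) (f (suc n)))
                             (cong (_+q (c *q f (suc n))) (sumTo-*ˡ n c f))

sumTo-single : ∀ n k (f : ℕ → ℚ) → k ≤ n → (∀ i → i ≤ n → i ≢ k → f i ≡ 0ℚ) → sumTo n f ≡ f k
sumTo-single zero .zero f z≤n _ = refl
sumTo-single (suc n) k f k≤1+n f≡0 with k ℕ.≟ suc n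
... | yes refl = trans (cong (_+q f (suc n)) (sumTo-zero n f others)) (ℚ.+-identityˡ _)
  where
  others : ∀ i → i ≤ n → f i ≡ 0ℚ
  others i i≤n = f≡0 i (ℕ.m≤n⇒m≤1+n i≤n) (λ i≡1+n → ℕ.<-irrefl i≡1+n (s≤s i≤n))
... | no k≢1+n = trans (cong₂ _+q_ (sumTo-single n k f k≤n (λ i i≤n → f≡0 i (ℕ.m≤n⇒m≤1+n i≤n)))
                                   (f≡0 (suc n) ℕ.≤-refl (k≢1+n ∘ sym)))
                       (ℚ.+-identityʳ _)
  where
  k≤n : k ≤ n
  k≤n = ℕ.≤-pred (ℕ.≤∧≢⇒< k≤1+n k≢1+n)

sumTo-swap : ∀ n m (F : ℕ → ℕ → ℚ) →
  sumTo n (λ i → sumTo m (F i)) ≡ sumTo m (λ j → sumTo n (λ i → F i j))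
sumTo-swap zero    m F = refl
sumTo-swap (suc n) m F = trans (cong (_+q sumTo m (F (suc n))) (sumTo-swap n m F))
                               (sym (sumTo-+ m _ (F (suc n))))

sumTo-unfoldˡ : ∀ n (f : ℕ → ℚ) → sumTo (suc n) f ≡ f 0 +q sumTo n (f ∘ suc)
sumTo-unfoldˡ zero    f = refl
sumTo-unfoldˡ (suc n) f = trans (cong (_+q f (2 + n)) (sumTo-unfoldˡ n f)) (ℚ.+-assoc (f 0) _ _)

sumTo-reverse : ∀ n (f : ℕ → ℚ) → sumTo n f ≡ sumTo n (λ i → f (n ∸ i))
sumTo-reverse zero    f = refl
sumTo-reverse (suc n) f = begin
  sumTo n f +q f (suc n)                 ≡⟨ cong (_+q f (suc n)) (sumTo-reverse n f) ⟩
  sumTo n (λ i → f (n ∸ i)) +q f (suc n) ≡⟨ ℚ.+-comm _ (f (suc n)) ⟩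
  f (suc n) +q sumTo n (λ i → f (n ∸ i)) ≡⟨ sym (sumTo-unfoldˡ n (λ i → f (suc n ∸ i))) ⟩
  sumTo (suc n) (λ i → f (suc n ∸ i))    ∎
  where open ≡-Reasoning

sumTo-triangle : ∀ n (F : ℕ → ℕ → ℚ) →
  sumTo n (λ i → sumTo i (F i)) ≡ sumTo n (λ j → sumTo (n ∸ j) (λ k → F (j + k) j))
sumTo-triangle zero    F = refl
sumTo-triangle (suc n) F = begin
  sumTo n (λ i → sumTo i (F i)) +q (sumTo n (F (suc n)) +q F (suc n) (suc n))
    ≡⟨ cong (_+q (sumTo n (F (suc n)) +q F (suc n) (suc n))) (sumTo-triangle n F) ⟩
  sumTo n inner +q (sumTo n (F (suc n)) +q F (suc n) (suc n))
    ≡⟨ sym (ℚ.+-assoc (sumTo n inner) _ _) ⟩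
  (sumTo n inner +q sumTo n (F (suc n))) +q F (suc n) (suc n)
    ≡⟨ cong₂ _+q_ (trans (sym (sumTo-+ n inner (F (suc n)))) (sumTo-cong n extend))
                  (cong (λ m → F m (suc n)) (sym (ℕ.+-identityʳ (suc n)))) ⟩
  sumTo n (λ j → sumTo (suc n ∸ j) (λ k → F (j + k) j)) +q F (suc n + 0) (suc n)
    ≡⟨ cong (λ m → sumTo n (λ j → sumTo (suc n ∸ j) (λ k → F (j + k) j)) +q
                    sumTo m (λ k → F (suc n + k) (suc n)))
            (sym (ℕ.n∸n≡0 (suc n))) ⟩
  sumTo (suc n) (λ j → sumTo (suc n ∸ j) (λ k → F (j + k) j)) ∎
  where
  open ≡-Reasoning
  inner : ℕ → ℚ
  inner j = sumTo (n ∸ j) (λ k → F (j + k) j)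
  extend : ∀ j → j ≤ n → inner j +q F (suc n) j ≡ sumTo (suc n ∸ j) (λ k → F (j + k) j)
  extend j j≤n rewrite ℕ.+-∸-assoc 1 j≤n =
    cong (λ m → inner j +q F m j)
         (trans (cong suc (sym (ℕ.m+[n∸m]≡n j≤n))) (sym (ℕ.+-suc j (n ∸ j))))

0s 1s : Series
0s = cst 0ℚ
1s = cst 1ℚ

0s-coeff : ∀ i → 0s i ≡ 0ℚ
0s-coeff zero    = refl
0s-coeff (suc i) = refl

negate : Series → Series
negate a i = - a i

⊛-comm : ∀ a b → a ⊛ b ≗ b ⊛ a
⊛-comm a b n = begin
  sumTo n (λ i → a i *q b (n ∸ i))             ≡⟨ sumTo-reverse n _ ⟩
  sumTo n (λ i → a (n ∸ i) *q b (n ∸ (n ∸ i))) ≡⟨ sumTo-cong n swapFactors ⟩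
  sumTo n (λ i → b i *q a (n ∸ i))             ∎
  where
  open ≡-Reasoning
  swapFactors : ∀ i → i ≤ n → a (n ∸ i) *q b (n ∸ (n ∸ i)) ≡ b i *q a (n ∸ i)
  swapFactors i i≤n = trans (cong (λ j → a (n ∸ i) *q b j) (ℕ.m∸[m∸n]≡n i≤n)) (ℚ.*-comm (a (n ∸ i)) (b i))

⊛-assoc : ∀ a b c → (a ⊛ b) ⊛ c ≗ a ⊛ (b ⊛ c)
⊛-assoc a b c n = begin
  sumTo n (λ i → sumTo i (λ j → a j *q b (i ∸ j)) *q c (n ∸ i))
    ≡⟨ sumTo-cong n (λ i _ → sumTo-*ʳ i (c (n ∸ i)) _) ⟩
  sumTo n (λ i → sumTo i (λ j → (a j *q b (i ∸ j)) *q c (n ∸ i)))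
    ≡⟨ sumTo-triangle n (λ i j → (a j *q b (i ∸ j)) *q c (n ∸ i)) ⟩
  sumTo n (λ j → sumTo (n ∸ j) (λ k → (a j *q b (j + k ∸ j)) *q c (n ∸ (j + k))))
    ≡⟨ sumTo-cong n (λ j _ → sumTo-cong (n ∸ j) (λ k _ → reassociate j k)) ⟩
  sumTo n (λ j → sumTo (n ∸ j) (λ k → a j *q (b k *q c (n ∸ j ∸ k))))
    ≡⟨ sumTo-cong n (λ j _ → sym (sumTo-*ˡ (n ∸ j) (a j) _)) ⟩
  sumTo n (λ j → a j *q sumTo (n ∸ j) (λ k → b k *q c (n ∸ j ∸ k))) ∎
  where
  open ≡-Reasoning
  sumTo-*ʳ : ∀ m c (f : ℕ → ℚ) → sumTo m f *q c ≡ sumTo m (λ i → f i *q c)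
  sumTo-*ʳ m c f = trans (ℚ.*-comm (sumTo m f) c)
                         (trans (sumTo-*ˡ m c f) (sumTo-cong m (λ i _ → ℚ.*-comm c (f i))))
  reassociate : ∀ j k → (a j *q b (j + k ∸ j)) *q c (n ∸ (j + k)) ≡ a j *q (b k *q c (n ∸ j ∸ k))
  reassociate j k rewrite ℕ.m+n∸m≡n j k | sym (ℕ.∸-+-assoc n j k) = ℚ.*-assoc (a j) (b k) _

⊛-distribˡ-⊕ : ∀ a b c → a ⊛ (b ⊕ c) ≗ (a ⊛ b) ⊕ (a ⊛ c)
⊛-distribˡ-⊕ a b c n =
  trans (sumTo-cong n (λ i _ → ℚ.*-distribˡ-+ (a i) (b (n ∸ i)) (c (n ∸ i)))) (sumTo-+ n _ _)

⊛-identityˡ : ∀ a → 1s ⊛ a ≗ a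
⊛-identityˡ a n = trans (sumTo-single n 0 _ z≤n onlyFirst) (ℚ.*-identityˡ (a n))
  where
  onlyFirst : ∀ i → i ≤ n → i ≢ 0 → 1s i *q a (n ∸ i) ≡ 0ℚ
  onlyFirst zero    _ 0≢0 = ⊥-elim (0≢0 refl)
  onlyFirst (suc i) _ _   = ℚ.*-zeroˡ (a (n ∸ suc i))

⊛-coeff-cong : ∀ {a a′ b b′} n → (∀ i → i ≤ n → a i ≡ a′ i) → (∀ i → i ≤ n → b i ≡ b′ i) →
               (a ⊛ b) n ≡ (a′ ⊛ b′) n
⊛-coeff-cong n a≡a′ b≡b′ =
  sumTo-cong n (λ i i≤n → cong₂ _*q_ (a≡a′ i i≤n) (b≡b′ (n ∸ i) (ℕ.m∸n≤m n i)))

⊛-zeroˡ : ∀ a b → (∀ i → a i ≡ 0ℚ) → ∀ n → (a ⊛ b) n ≡ 0ℚ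
⊛-zeroˡ a b a≡0 n =
  sumTo-zero n _ (λ i _ → trans (cong (_*q b (n ∸ i)) (a≡0 i)) (ℚ.*-zeroˡ (b (n ∸ i))))

⊛-zeroʳ : ∀ a b → (∀ i → b i ≡ 0ℚ) → ∀ n → (a ⊛ b) n ≡ 0ℚ
⊛-zeroʳ a b b≡0 n = trans (⊛-comm a b n) (⊛-zeroˡ b a b≡0 n)

qPow : ℕ → Series
qPow zero    zero    = 1ℚ
qPow zero    (suc i) = 0ℚ
qPow (suc k) zero    = 0ℚ
qPow (suc k) (suc i) = qPow k i

qPow-diag : ∀ k → qPow k k ≡ 1ℚ
qPow-diag zero    = refl
qPow-diag (suc k) = qPow-diag k

qPow-offDiag : ∀ {i k} → i ≢ k → qPow k i ≡ 0ℚ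
qPow-offDiag {zero}  {zero}  0≢0 = ⊥-elim (0≢0 refl)
qPow-offDiag {zero}  {suc k} _   = refl
qPow-offDiag {suc i} {zero}  _   = refl
qPow-offDiag {suc i} {suc k} i≢k = qPow-offDiag (i≢k ∘ cong suc)

qPow-zero : qPow 0 ≗ 1s
qPow-zero zero    = refl
qPow-zero (suc i) = refl

qPow-⊛ : ∀ k i a → k ≤ i → (qPow k ⊛ a) i ≡ a (i ∸ k)
qPow-⊛ k i a k≤i = begin
  (qPow k ⊛ a) i        ≡⟨ sumTo-single i k _ k≤i (λ j _ j≢k → vanish j j≢k) ⟩
  qPow k k *q a (i ∸ k) ≡⟨ cong (_*q a (i ∸ k)) (qPow-diag k) ⟩
  1ℚ *q a (i ∸ k)       ≡⟨ ℚ.*-identityˡ (a (i ∸ k)) ⟩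
  a (i ∸ k)             ∎
  where
  open ≡-Reasoning
  vanish : ∀ j → j ≢ k → qPow k j *q a (i ∸ j) ≡ 0ℚ
  vanish j j≢k = trans (cong (_*q a (i ∸ j)) (qPow-offDiag j≢k)) (ℚ.*-zeroˡ (a (i ∸ j)))

qPow-⊛-below : ∀ k i a → i < k → (qPow k ⊛ a) i ≡ 0ℚ
qPow-⊛-below k i a i<k = sumTo-zero i _ vanish
  where
  vanish : ∀ j → j ≤ i → qPow k j *q a (i ∸ j) ≡ 0ℚ
  vanish j j≤i = trans (cong (_*q a (i ∸ j)) (qPow-offDiag (ℕ.<⇒≢ (ℕ.≤-<-trans j≤i i<k))))
                       (ℚ.*-zeroˡ (a (i ∸ j)))

qPow-+ : ∀ k l → qPow k ⊛ qPow l ≗ qPow (k + l)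
qPow-+ k l i with k ℕ.≤? i
... | yes k≤i = trans (qPow-⊛ k i (qPow l) k≤i) (shift k i k≤i)
  where
  shift : ∀ k i → k ≤ i → qPow l (i ∸ k) ≡ qPow (k + l) i
  shift zero    i       _         = refl
  shift (suc k) (suc i) (s≤s k≤i) = shift k i k≤i
... | no k≰i = trans (qPow-⊛-below k i (qPow l) i<k) (sym (qPow-offDiag i≢k+l))
  where
  i<k : i < k
  i<k = ℕ.≰⇒> k≰i
  i≢k+l : i ≢ k + l
  i≢k+l = ℕ.<⇒≢ (ℕ.<-≤-trans i<k (ℕ.m≤m+n k l))

OrderAtLeast : ℕ → Series → Set
OrderAtLeast p a = ∀ i → i < p → a i ≡ 0ℚ

⊛-order : ∀ {p r a b} → OrderAtLeast p a → OrderAtLeast r b → OrderAtLeast (p + r) (a ⊛ b)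
⊛-order {p} {r} {a} {b} ordA ordB i i<p+r = sumTo-zero i _ vanish
  where
  vanish : ∀ j → j ≤ i → a j *q b (i ∸ j) ≡ 0ℚ
  vanish j j≤i with j ℕ.<? p
  ... | yes j<p = trans (cong (_*q b (i ∸ j)) (ordA j j<p)) (ℚ.*-zeroˡ (b (i ∸ j)))
  ... | no j≮p  = trans (cong (a j *q_) (ordB (i ∸ j) i∸j<r)) (ℚ.*-zeroʳ (a j))
    where
    i∸j<r : i ∸ j < r
    i∸j<r = ℕ.+-cancelˡ-< j (i ∸ j) r
              (subst (_< j + r) (sym (ℕ.m+[n∸m]≡n j≤i))
                     (ℕ.<-≤-trans i<p+r (ℕ.+-monoˡ-≤ r (ℕ.≮⇒≥ j≮p))))

order-0 : ∀ a → OrderAtLeast 0 a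
order-0 a i ()

qPow-order : ∀ k → OrderAtLeast k (qPow k)
qPow-order k i i<k = qPow-offDiag (ℕ.<⇒≢ i<k)

-- q^m/(1 − q^m) = Σ_{r ≥ 1} q^{rm}
geomTail : ℕ → Series
geomTail m zero    = 0ℚ
geomTail m (suc i) = if does (m ∣? suc i) then 1ℚ else 0ℚ

geomTail-order : ∀ m → OrderAtLeast m (geomTail m)
geomTail-order m zero    _   = refl
geomTail-order m (suc i) i<m with m ∣? suc i
... | yes m∣1+i = ⊥-elim (ℕ.<⇒≱ i<m (∣⇒≤ m∣1+i))
... | no  _     = refl

geomTail-zero : ∀ i → geomTail 0 i ≡ 0ℚ
geomTail-zero zero    = refl
geomTail-zero (suc i) with 0 ∣? suc i
... | yes 0∣1+i with () ← 0∣⇒≡0 0∣1+i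
... | no  _     = refl

geomTail-periodic : ∀ m i → m < i → geomTail m i ≡ geomTail m (i ∸ m)
geomTail-periodic m (suc i) (s≤s m≤i) = begin
  geomTail m (suc i)             ≡⟨ cong (geomTail m ∘ suc) (sym (ℕ.m+[n∸m]≡n m≤i)) ⟩
  geomTail m (suc (m + (i ∸ m))) ≡⟨ shift (i ∸ m) ⟩
  geomTail m (suc (i ∸ m))       ≡⟨ cong (geomTail m) (sym (ℕ.+-∸-assoc 1 m≤i)) ⟩
  geomTail m (suc i ∸ m)         ∎
  where
  open ≡-Reasoning
  shift : ∀ k → geomTail m (suc (m + k)) ≡ geomTail m (suc k)
  shift k with m ∣? suc (m + k) | m ∣? suc k
  ... | yes _ | yes _ = refl
  ... | no  _ | no  _ = refl
  ... | yes m∣m+1+k | no m∤1+k = ⊥-elim (m∤1+k (∣m+n∣m⇒∣n (subst (m ∣_) (sym (ℕ.+-suc m k)) m∣m+1+k) ∣-refl))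
  ... | no m∤m+1+k | yes m∣1+k = ⊥-elim (m∤m+1+k (subst (m ∣_) (ℕ.+-suc m k) (∣m∣n⇒∣m+n ∣-refl m∣1+k)))

geomTail-multiple : ∀ m i → m ∣ suc i → geomTail m (suc i) ≡ 1ℚ
geomTail-multiple m i m∣1+i with m ∣? suc i
... | yes _     = refl
... | no m∤1+i = ⊥-elim (m∤1+i m∣1+i)

geom : ℕ → Series
geom m = 1s ⊕ geomTail m

geomTail-unfold : ∀ m → 1 ≤ m → geomTail m ≗ qPow m ⊕ (qPow m ⊛ geomTail m)
geomTail-unfold m@(suc m-1) _ i with ℕ.<-cmp i m
... | tri< i<m _ _ = begin
  geomTail m i                               ≡⟨ geomTail-order m i i<m ⟩
  0ℚ +q 0ℚ
    ≡⟨ cong₂ _+q_ (sym (qPow-order m i i<m)) (sym (qPow-⊛-below m i (geomTail m) i<m)) ⟩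
  qPow m i +q (qPow m ⊛ geomTail m) i        ∎
  where open ≡-Reasoning
... | tri≈ _ refl _ = begin
  geomTail m m                               ≡⟨ diag ⟩
  1ℚ +q 0ℚ
    ≡⟨ cong₂ _+q_ (sym (qPow-diag m)) (cong (geomTail m) (sym (ℕ.n∸n≡0 m))) ⟩
  qPow m m +q geomTail m (m ∸ m)             ≡⟨ cong (qPow m m +q_) (sym (qPow-⊛ m m (geomTail m) ℕ.≤-refl)) ⟩
  qPow m m +q (qPow m ⊛ geomTail m) m        ∎
  where
  open ≡-Reasoning
  diag : geomTail m m ≡ 1ℚ +q 0ℚ
  diag = trans (geomTail-multiple m m-1 ∣-refl) (sym (ℚ.+-identityʳ 1ℚ))
... | tri> _ _ m<i = begin
  geomTail m i                               ≡⟨ geomTail-periodic m i m<i ⟩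
  geomTail m (i ∸ m)                         ≡⟨ sym (ℚ.+-identityˡ _) ⟩
  0ℚ +q geomTail m (i ∸ m)
    ≡⟨ cong₂ _+q_ (sym (qPow-offDiag (ℕ.>⇒≢ m<i))) (sym (qPow-⊛ m i (geomTail m) (ℕ.<⇒≤ m<i))) ⟩
  qPow m i +q (qPow m ⊛ geomTail m) i        ∎
  where open ≡-Reasoning

sumS : ℕ → (ℕ → Series) → Series
sumS n f i = sumTo n (λ k → f k i)

when : Bool → Series → Series
when true  a = a
when false a = 0s

δ₀ : ℕ → Series
δ₀ zero    = 1s
δ₀ (suc _) = 0s

≤ᵇ-true : ∀ {m n} → m ≤ n → (m ≤ᵇ n) ≡ true
≤ᵇ-true z≤n                 = refl
≤ᵇ-true (s≤s z≤n)           = refl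
≤ᵇ-true (s≤s m≤n@(s≤s _))   = ≤ᵇ-true m≤n

≤ᵇ-false : ∀ {m n} → n < m → (m ≤ᵇ n) ≡ false
≤ᵇ-false {suc m}       {zero}  _               = refl
≤ᵇ-false {suc (suc m)} {suc n} (s≤s n<1+m)     = ≤ᵇ-false n<1+m

data Kind : Set where
  X Y : Kind

swapKind : Kind → Kind
swapKind X = Y
swapKind Y = X

countX : List Kind → ℕ
countX []      = 0
countX (X ∷ v) = suc (countX v)
countX (Y ∷ v) = countX v

kindFactor : Kind → ℕ → ℕ → Series
kindFactor X n d = 1s
kindFactor Y n d = geomTail (n + d)

partialK : ℕ → List Kind → Series
partialK M []      = 1s
partialK M (k ∷ v) = sumS M (λ n → kindFactor k n (countX (k ∷ v)) ⊛ partialK n v)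

-- δ₀ makes partialK M v = Σ_{n ≤ M} partialTerm v n hold for v = [] as well.
partialTerm : List Kind → ℕ → Series
partialTerm []      n = δ₀ n
partialTerm (k ∷ v) n = kindFactor k n (countX (k ∷ v)) ⊛ partialK n v

countX-∷ʳ-X : ∀ v → 1 ≤ countX (v ++ [ X ])
countX-∷ʳ-X []      = s≤s z≤n
countX-∷ʳ-X (X ∷ v) = ℕ.m≤n⇒m≤1+n (countX-∷ʳ-X v)
countX-∷ʳ-X (Y ∷ v) = countX-∷ʳ-X v

map-swapKind-involutive : ∀ v → map swapKind (map swapKind v) ≡ v
map-swapKind-involutive []      = refl
map-swapKind-involutive (X ∷ v) = cong (X ∷_) (map-swapKind-involutive v)
map-swapKind-involutive (Y ∷ v) = cong (Y ∷_) (map-swapKind-involutive v)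

τK : List Kind → List Kind
τK v = reverse (map swapKind v)

τK-shape : ∀ v → τK (Y ∷ v ++ [ X ]) ≡ Y ∷ τK v ++ [ X ]
τK-shape v = begin
  reverse (X ∷ map swapKind (v ++ [ X ]))           ≡⟨ List.unfold-reverse X (map swapKind (v ++ [ X ])) ⟩
  reverse (map swapKind (v ++ [ X ])) ++ [ X ]      ≡⟨ cong (λ w → reverse w ++ [ X ]) (List.map-++ swapKind v [ X ]) ⟩
  reverse (map swapKind v ++ [ Y ]) ++ [ X ]        ≡⟨ cong (_++ [ X ]) (List.reverse-++ (map swapKind v) [ Y ]) ⟩
  Y ∷ τK v ++ [ X ]                                 ∎
  where open ≡-Reasoning

module UpToDegree (N : ℕ) where

  infix 4 _≈_
  -- A record rather than a function, so that unification can recover a and b from a ≈ b.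
  record _≈_ (a b : Series) : Set where
    constructor agreeUpTo
    field coeff : ∀ i → i ≤ N → a i ≡ b i
  open _≈_ public

  ≗⇒≈ : ∀ {a b} → a ≗ b → a ≈ b
  ≗⇒≈ a≗b = agreeUpTo (λ i _ → a≗b i)

  ≈-refl : ∀ {a} → a ≈ a
  ≈-refl = agreeUpTo (λ _ _ → refl)

  ≈-sym : ∀ {a b} → a ≈ b → b ≈ a
  ≈-sym a≈b = agreeUpTo (λ i i≤N → sym (coeff a≈b i i≤N))

  ≈-trans : ∀ {a b c} → a ≈ b → b ≈ c → a ≈ c
  ≈-trans a≈b b≈c = agreeUpTo (λ i i≤N → trans (coeff a≈b i i≤N) (coeff b≈c i i≤N))

  ⊕-cong : ∀ {a a′ b b′} → a ≈ a′ → b ≈ b′ → a ⊕ b ≈ a′ ⊕ b′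
  ⊕-cong a≈a′ b≈b′ = agreeUpTo (λ i i≤N → cong₂ _+q_ (coeff a≈a′ i i≤N) (coeff b≈b′ i i≤N))

  ⊛-cong : ∀ {a a′ b b′} → a ≈ a′ → b ≈ b′ → a ⊛ b ≈ a′ ⊛ b′
  ⊛-cong a≈a′ b≈b′ = agreeUpTo λ i i≤N →
    ⊛-coeff-cong i (λ j j≤i → coeff a≈a′ j (ℕ.≤-trans j≤i i≤N))
                   (λ j j≤i → coeff b≈b′ j (ℕ.≤-trans j≤i i≤N))

  ⊕-congˡ : ∀ a {b c} → b ≈ c → a ⊕ b ≈ a ⊕ c
  ⊕-congˡ a = ⊕-cong (≈-refl {a})

  ⊕-congʳ : ∀ c {a b} → a ≈ b → a ⊕ c ≈ b ⊕ c
  ⊕-congʳ c a≈b = ⊕-cong a≈b (≈-refl {c})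

  ⊛-congˡ : ∀ a {b c} → b ≈ c → a ⊛ b ≈ a ⊛ c
  ⊛-congˡ a = ⊛-cong (≈-refl {a})

  ⊛-congʳ : ∀ c {a b} → a ≈ b → a ⊛ c ≈ b ⊛ c
  ⊛-congʳ c a≈b = ⊛-cong a≈b (≈-refl {c})

  negate-cong : ∀ {a a′} → a ≈ a′ → negate a ≈ negate a′
  negate-cong a≈a′ = agreeUpTo (λ i i≤N → cong -_ (coeff a≈a′ i i≤N))

  isCommutativeRing : IsCommutativeRing _≈_ _⊕_ _⊛_ negate 0s 1s
  isCommutativeRing = record
    { isRing = record
      { +-isAbelianGroup = record
        { isGroup = record
          { isMonoid = record
            { isSemigroup = record
              { isMagma = record
                { isEquivalence = record { refl = ≈-refl ; sym = ≈-sym ; trans = ≈-trans }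
                ; ∙-cong = ⊕-cong }
              ; assoc = λ a b c → ≗⇒≈ (λ i → ℚ.+-assoc (a i) (b i) (c i)) }
            ; identity = (λ a → ≗⇒≈ (λ i → trans (cong (_+q a i) (0s-coeff i)) (ℚ.+-identityˡ (a i))))
                       , (λ a → ≗⇒≈ (λ i → trans (cong (a i +q_) (0s-coeff i)) (ℚ.+-identityʳ (a i)))) }
          ; inverse = (λ a → ≗⇒≈ (λ i → trans (ℚ.+-inverseˡ (a i)) (sym (0s-coeff i))))
                    , (λ a → ≗⇒≈ (λ i → trans (ℚ.+-inverseʳ (a i)) (sym (0s-coeff i))))
          ; ⁻¹-cong = negate-cong }
        ; comm = λ a b → ≗⇒≈ (λ i → ℚ.+-comm (a i) (b i)) }
      ; *-cong = ⊛-cong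
      ; *-assoc = λ a b c → ≗⇒≈ (⊛-assoc a b c)
      ; *-identity = (λ a → ≗⇒≈ (⊛-identityˡ a))
                   , (λ a → ≗⇒≈ (λ i → trans (⊛-comm a 1s i) (⊛-identityˡ a i)))
      ; distrib = (λ a b c → ≗⇒≈ (⊛-distribˡ-⊕ a b c))
                , (λ a b c → ≗⇒≈ (λ i → trans (⊛-comm (b ⊕ c) a i)
                                      (trans (⊛-distribˡ-⊕ a b c i)
                                             (cong₂ _+q_ (⊛-comm a b i) (⊛-comm a c i))))) }
    ; *-comm = λ a b → ≗⇒≈ (⊛-comm a b) }

  seriesRing : CommutativeRing _ _
  seriesRing = record { isCommutativeRing = isCommutativeRing }

  open import Relation.Binary.Reasoning.Setoid (CommutativeRing.setoid seriesRing) public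

  private
    cst-⊛ : ∀ a b → cst (a *q b) ≗ cst a ⊛ cst b
    cst-⊛ a b zero    = refl
    cst-⊛ a b (suc n) = sym (sumTo-zero (suc n) _ vanish)
      where
      vanish : ∀ i → i ≤ suc n → cst a i *q cst b (suc n ∸ i) ≡ 0ℚ
      vanish zero    _ = ℚ.*-zeroʳ a
      vanish (suc i) _ = ℚ.*-zeroˡ (cst b (suc n ∸ suc i))

    constants : CommutativeRing.rawRing ℚ.+-*-commutativeRing
                  -Raw-AlmostCommutative⟶ fromCommutativeRing seriesRing
    constants = record
      { ⟦_⟧    = cst
      ; +-homo = λ a b → ≗⇒≈ (λ { zero → refl ; (suc i) → refl })
      ; *-homo = λ a b → ≗⇒≈ (cst-⊛ a b)
      ; -‿homo = λ a → ≗⇒≈ (λ { zero → refl ; (suc i) → refl })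
      ; 0-homo = ≗⇒≈ (λ { zero → refl ; (suc i) → refl })
      ; 1-homo = ≗⇒≈ (λ { zero → refl ; (suc i) → refl }) }

    cst-≟ : ∀ (a b : ℚ) → Maybe (cst a ≈ cst b)
    cst-≟ a b with a ℚ.≟ b
    ... | yes refl = just ≈-refl
    ... | no  _    = nothing

  open RingSolver (CommutativeRing.rawRing ℚ.+-*-commutativeRing)
                  (fromCommutativeRing seriesRing) constants cst-≟ public
    using (solve; _:=_; _:+_; _:*_; :-_; con)

  _⊝_ : Series → Series → Series
  a ⊝ b = a ⊕ negate b
  infixl 6 _⊝_


  sumS-cong : ∀ n {f g : ℕ → Series} → (∀ k → k ≤ n → f k ≈ g k) → sumS n f ≈ sumS n g
  sumS-cong n f≈g = agreeUpTo (λ i i≤N → sumTo-cong n (λ k k≤n → coeff (f≈g k k≤n) i i≤N))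

  sumS-zero : ∀ n (f : ℕ → Series) → (∀ k → k ≤ n → f k ≈ 0s) → sumS n f ≈ 0s
  sumS-zero n f f≈0 = agreeUpTo λ i i≤N →
    trans (sumTo-zero n _ (λ k k≤n → trans (coeff (f≈0 k k≤n) i i≤N) (0s-coeff i))) (sym (0s-coeff i))

  sumS-⊕ : ∀ n (f g : ℕ → Series) → sumS n (λ k → f k ⊕ g k) ≈ sumS n f ⊕ sumS n g
  sumS-⊕ n f g = ≗⇒≈ (λ i → sumTo-+ n (λ k → f k i) (λ k → g k i))

  sumS-swap : ∀ n m (F : ℕ → ℕ → Series) → sumS n (λ k → sumS m (F k)) ≈ sumS m (λ l → sumS n (λ k → F k l))
  sumS-swap n m F = ≗⇒≈ (λ i → sumTo-swap n m (λ k l → F k l i))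

  ⊛-sumS : ∀ n a (f : ℕ → Series) → a ⊛ sumS n f ≈ sumS n (λ k → a ⊛ f k)
  ⊛-sumS n a f = ≗⇒≈ λ i →
    trans (sumTo-cong i (λ j _ → sumTo-*ˡ n (a j) (λ k → f k (i ∸ j)))) (sumTo-swap i n _)

  sumS-⊛ : ∀ n (f : ℕ → Series) a → sumS n f ⊛ a ≈ sumS n (λ k → f k ⊛ a)
  sumS-⊛ n f a = begin
    sumS n f ⊛ a              ≈⟨ ≗⇒≈ (⊛-comm (sumS n f) a) ⟩
    a ⊛ sumS n f              ≈⟨ ⊛-sumS n a f ⟩
    sumS n (λ k → a ⊛ f k)    ≈⟨ sumS-cong n (λ k _ → ≗⇒≈ (⊛-comm a (f k))) ⟩
    sumS n (λ k → f k ⊛ a)    ∎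

  when-cong : ∀ b {a a′} → a ≈ a′ → when b a ≈ when b a′
  when-cong true  a≈a′ = a≈a′
  when-cong false _    = ≈-refl

  when-true : ∀ {b} a → b ≡ true → when b a ≈ a
  when-true a refl = ≈-refl

  when-false : ∀ {b} a → b ≡ false → when b a ≈ 0s
  when-false a refl = ≈-refl

  when-zero : ∀ b {a} → a ≈ 0s → when b a ≈ 0s
  when-zero true  a≈0 = a≈0
  when-zero false _   = ≈-refl

  when-⊕ : ∀ b {a c d} → a ≈ c ⊕ d → when b a ≈ when b c ⊕ when b d
  when-⊕ true  a≈c⊕d = a≈c⊕d
  when-⊕ false _     = solve 0 (con 0ℚ := con 0ℚ :+ con 0ℚ) ≈-refl

  when-⊛ : ∀ b a c → when b a ⊛ c ≈ when b (a ⊛ c)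
  when-⊛ true  a c = ≈-refl
  when-⊛ false a c = solve 1 (λ c → con 0ℚ :* c := con 0ℚ) ≈-refl c

  ⊛-when : ∀ b a c → a ⊛ when b c ≈ when b (a ⊛ c)
  ⊛-when true  a c = ≈-refl
  ⊛-when false a c = solve 1 (λ a → a :* con 0ℚ := con 0ℚ) ≈-refl a

  when-sumS : ∀ b n (f : ℕ → Series) → when b (sumS n f) ≈ sumS n (λ k → when b (f k))
  when-sumS true  n f = ≈-refl
  when-sumS false n f = ≈-sym (sumS-zero n _ (λ _ _ → ≈-refl))

  sumS-single : ∀ n k (f : ℕ → Series) → k ≤ n → (∀ j → j ≤ n → j ≢ k → f j ≈ 0s) → sumS n f ≈ f k
  sumS-single n k f k≤n others = agreeUpTo λ i i≤N →
    sumTo-single n k (λ j → f j i) k≤n (λ j j≤n j≢k → trans (coeff (others j j≤n j≢k) i i≤N) (0s-coeff i))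

  sumS-δ₀ : ∀ n (f : ℕ → Series) → sumS n (λ k → δ₀ k ⊛ f k) ≈ f 0
  sumS-δ₀ n f = ≗⇒≈ λ i →
    trans (sumTo-single n 0 (λ k → (δ₀ k ⊛ f k) i) z≤n (λ k _ k≢0 → vanish k k≢0 i)) (⊛-identityˡ (f 0) i)
    where
    vanish : ∀ k → k ≢ 0 → ∀ i → (δ₀ k ⊛ f k) i ≡ 0ℚ
    vanish zero    0≢0 = ⊥-elim (0≢0 refl)
    vanish (suc k) _   = ⊛-zeroˡ 0s (f (suc k)) 0s-coeff

  sumS-extend : ∀ n → n ≤ N → (f : ℕ → Series) → sumS n f ≈ sumS N (λ k → when (k ≤ᵇ n) (f k))
  sumS-extend n n≤N f =
    subst (λ M → sumS n f ≈ sumS M (λ k → when (k ≤ᵇ n) (f k))) (ℕ.m+[n∸m]≡n n≤N) (go (N ∸ n))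
    where
    go : ∀ j → sumS n f ≈ sumS (n + j) (λ k → when (k ≤ᵇ n) (f k))
    go zero rewrite ℕ.+-identityʳ n =
      sumS-cong n (λ k k≤n → ≈-sym (when-true (f k) (≤ᵇ-true k≤n)))
    go (suc j) rewrite ℕ.+-suc n j = begin
      sumS n f
        ≈⟨ solve 1 (λ x → x := x :+ con 0ℚ) ≈-refl (sumS n f) ⟩
      sumS n f ⊕ 0s
        ≈⟨ ⊕-cong (go j) beyond ⟩
      sumS (n + j) (λ k → when (k ≤ᵇ n) (f k)) ⊕ when (suc (n + j) ≤ᵇ n) (f (suc (n + j))) ∎
      where
      beyond : 0s ≈ when (suc (n + j) ≤ᵇ n) (f (suc (n + j)))
      beyond = ≈-sym (when-false (f (suc (n + j))) (≤ᵇ-false (s≤s (ℕ.m≤m+n n j))))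

  sumS-beyond : ∀ (f : ℕ → Series) → (∀ k → N < k → f k ≈ 0s) → ∀ M → N ≤ M → sumS M f ≈ sumS N f
  sumS-beyond f f≈0 M N≤M = subst (λ M → sumS M f ≈ sumS N f) (ℕ.m+[n∸m]≡n N≤M) (go (M ∸ N))
    where
    go : ∀ j → sumS (N + j) f ≈ sumS N f
    go zero    rewrite ℕ.+-identityʳ N = ≈-refl
    go (suc j) rewrite ℕ.+-suc N j = begin
      sumS (N + j) f ⊕ f (suc (N + j)) ≈⟨ ⊕-cong (go j) (f≈0 (suc (N + j)) (s≤s (ℕ.m≤m+n N j))) ⟩
      sumS N f ⊕ 0s                    ≈⟨ solve 1 (λ x → x :+ con 0ℚ := x) ≈-refl (sumS N f) ⟩
      sumS N f                         ∎

  guarded-⊛ : ∀ n (b : ℕ → Bool) (f : ℕ → Series) a →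
    sumS n (λ k → when (b k) (f k)) ⊛ a ≈ sumS n (λ k → when (b k) (f k ⊛ a))
  guarded-⊛ n b f a =
    ≈-trans (sumS-⊛ n (λ k → when (b k) (f k)) a) (sumS-cong n (λ k _ → when-⊛ (b k) (f k) a))

  ⊛-guarded : ∀ n (b : ℕ → Bool) a (f : ℕ → Series) →
    a ⊛ sumS n (λ k → when (b k) (f k)) ≈ sumS n (λ k → when (b k) (a ⊛ f k))
  ⊛-guarded n b a f =
    ≈-trans (⊛-sumS n a (λ k → when (b k) (f k))) (sumS-cong n (λ k _ → ⊛-when (b k) a (f k)))

  guarded-sandwich : ∀ n (b : ℕ → Bool) a (f : ℕ → Series) c →
    sumS n (λ k → when (b k) (a ⊛ (f k ⊛ c))) ≈ a ⊛ (sumS n (λ k → when (b k) (f k)) ⊛ c)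
  guarded-sandwich n b a f c = ≈-sym (begin
    a ⊛ (sumS n (λ k → when (b k) (f k)) ⊛ c)   ≈⟨ ⊛-congˡ a (guarded-⊛ n b f c) ⟩
    a ⊛ sumS n (λ k → when (b k) (f k ⊛ c))     ≈⟨ ⊛-guarded n b a (λ k → f k ⊛ c) ⟩
    sumS n (λ k → when (b k) (a ⊛ (f k ⊛ c)))   ∎)

  triangle-swap : ∀ (a b : ℕ → Series) →
    sumS N (λ n → a n ⊛ sumS N (λ n′ → when (n′ ≤ᵇ n) (b n′)))
      ≈ sumS N (λ n′ → sumS N (λ n → when (n′ ≤ᵇ n) (a n)) ⊛ b n′)
  triangle-swap a b = begin
    sumS N (λ n → a n ⊛ sumS N (λ n′ → when (n′ ≤ᵇ n) (b n′)))
      ≈⟨ sumS-cong N (λ n _ → ⊛-guarded N (_≤ᵇ n) (a n) b) ⟩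
    sumS N (λ n → sumS N (λ n′ → when (n′ ≤ᵇ n) (a n ⊛ b n′)))
      ≈⟨ sumS-swap N N _ ⟩
    sumS N (λ n′ → sumS N (λ n → when (n′ ≤ᵇ n) (a n ⊛ b n′)))
      ≈⟨ sumS-cong N (λ n′ _ → ≈-sym (guarded-⊛ N (n′ ≤ᵇ_) a (b n′))) ⟩
    sumS N (λ n′ → sumS N (λ n → when (n′ ≤ᵇ n) (a n)) ⊛ b n′) ∎

  order>N⇒≈0 : ∀ {p a} → OrderAtLeast p a → N < p → a ≈ 0s
  order>N⇒≈0 ord N<p = agreeUpTo (λ i i≤N → trans (ord i (ℕ.≤-<-trans i≤N N<p)) (sym (0s-coeff i)))

  sumS-from-split : ∀ s → s ≤ N → (f : ℕ → Series) →
    sumS N (λ n → when (s ≤ᵇ n) (f n)) ≈ f s ⊕ sumS N (λ n → when (suc s ≤ᵇ n) (f n))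
  sumS-from-split s s≤N f = begin
    sumS N (λ n → when (s ≤ᵇ n) (f n))
      ≈⟨ sumS-cong N (λ n _ → solve 2 (λ x y → x := (x :+ :- y) :+ y) ≈-refl (when (s ≤ᵇ n) (f n)) (later n)) ⟩
    sumS N (λ n → difference n ⊕ later n)
      ≈⟨ sumS-⊕ N difference later ⟩
    sumS N difference ⊕ sumS N later
      ≈⟨ ⊕-congʳ (sumS N later) (≈-trans (sumS-single N s difference s≤N (λ n _ → vanish n)) atS) ⟩
    f s ⊕ sumS N later ∎
    where
    later difference : ℕ → Series
    later n = when (suc s ≤ᵇ n) (f n)
    difference n = when (s ≤ᵇ n) (f n) ⊝ later n
    vanish : ∀ n → n ≢ s → difference n ≈ 0s
    vanish n n≢s with ℕ.<-cmp n s
    ... | tri< n<s _ _ rewrite ≤ᵇ-false n<s | ≤ᵇ-false (ℕ.m<n⇒m<1+n n<s) =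
      solve 0 (con 0ℚ :+ :- con 0ℚ := con 0ℚ) ≈-refl
    ... | tri≈ _ n≡s _ = ⊥-elim (n≢s n≡s)
    ... | tri> _ _ s<n rewrite ≤ᵇ-true (ℕ.<⇒≤ s<n) | ≤ᵇ-true s<n =
      solve 1 (λ x → x :+ :- x := con 0ℚ) ≈-refl (f n)
    atS : difference s ≈ f s
    atS rewrite ≤ᵇ-true (ℕ.≤-refl {s}) | ≤ᵇ-false (ℕ.n<1+n s) =
      solve 1 (λ x → x :+ :- con 0ℚ := x) ≈-refl (f s)

  telescope : ∀ (g F : ℕ → Series) s → s ≤ suc N → (∀ n → s ≤ n → g n ≈ F n ⊝ F (suc n)) →
              F (suc N) ≈ 0s → sumS N (λ n → when (s ≤ᵇ n) (g n)) ≈ F s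
  telescope g F s s≤1+N step F[1+N]≈0 = go (suc N ∸ s) s (ℕ.m+[n∸m]≡n s≤1+N) step
    where
    go : ∀ j s → s + j ≡ suc N → (∀ n → s ≤ n → g n ≈ F n ⊝ F (suc n)) →
         sumS N (λ n → when (s ≤ᵇ n) (g n)) ≈ F s
    go zero s s+0≡1+N _ rewrite trans (sym (ℕ.+-identityʳ s)) s+0≡1+N = begin
      sumS N (λ n → when (suc N ≤ᵇ n) (g n))
        ≈⟨ sumS-zero N _ (λ n n≤N → when-false (g n) (≤ᵇ-false (s≤s n≤N))) ⟩
      0s
        ≈⟨ ≈-sym F[1+N]≈0 ⟩
      F (suc N) ∎
    go (suc j) s s+1+j≡1+N step = begin
      sumS N (λ n → when (s ≤ᵇ n) (g n))
        ≈⟨ sumS-from-split s s≤N g ⟩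
      g s ⊕ sumS N (λ n → when (suc s ≤ᵇ n) (g n))
        ≈⟨ ⊕-cong (step s ℕ.≤-refl) (go j (suc s) 1+s+j≡1+N (λ n s<n → step n (ℕ.<⇒≤ s<n))) ⟩
      (F s ⊝ F (suc s)) ⊕ F (suc s)
        ≈⟨ solve 2 (λ x y → (x :+ :- y) :+ y := x) ≈-refl (F s) (F (suc s)) ⟩
      F s ∎
      where
      1+s+j≡1+N : suc (s + j) ≡ suc N
      1+s+j≡1+N = trans (sym (ℕ.+-suc s j)) s+1+j≡1+N
      s≤N : s ≤ N
      s≤N = subst (s ≤_) (ℕ.suc-injective 1+s+j≡1+N) (ℕ.m≤m+n s j)

  geom-inverse : ∀ m → 1 ≤ m → geom m ⊛ (1s ⊝ qPow m) ≈ 1s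
  geom-inverse m 1≤m = begin
    geom m ⊛ (1s ⊝ qPow m)
      ≈⟨ solve 2 (λ x t → (con 1ℚ :+ t) :* (con 1ℚ :+ :- x) := con 1ℚ :+ (t :+ :- (x :+ x :* t))) ≈-refl
               (qPow m) (geomTail m) ⟩
    1s ⊕ (geomTail m ⊝ q+qt)
      ≈⟨ ⊕-congˡ 1s (⊕-congʳ (negate q+qt) (≗⇒≈ (geomTail-unfold m 1≤m))) ⟩
    1s ⊕ (q+qt ⊝ q+qt)
      ≈⟨ solve 1 (λ z → con 1ℚ :+ (z :+ :- z) := con 1ℚ) ≈-refl q+qt ⟩
    1s ∎
    where
    q+qt : Series
    q+qt = qPow m ⊕ (qPow m ⊛ geomTail m)

  geomTail≈qPow⊛geom : ∀ m → 1 ≤ m → geomTail m ≈ qPow m ⊛ geom m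
  geomTail≈qPow⊛geom m 1≤m = begin
    geomTail m
      ≈⟨ ≗⇒≈ (geomTail-unfold m 1≤m) ⟩
    qPow m ⊕ (qPow m ⊛ geomTail m)
      ≈⟨ solve 2 (λ x t → x :+ x :* t := x :* (con 1ℚ :+ t)) ≈-refl (qPow m) (geomTail m) ⟩
    qPow m ⊛ geom m ∎

  geom⊛qPow-+ : ∀ a k → 1 ≤ a → geom a ⊛ qPow (a + k) ≈ geomTail a ⊛ qPow k
  geom⊛qPow-+ a k 1≤a = begin
    geom a ⊛ qPow (a + k)
      ≈⟨ ⊛-congˡ (geom a) (≈-sym (≗⇒≈ (qPow-+ a k))) ⟩
    geom a ⊛ (qPow a ⊛ qPow k)
      ≈⟨ solve 3 (λ y x z → y :* (x :* z) := (x :* y) :* z) ≈-refl (geom a) (qPow a) (qPow k) ⟩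
    (qPow a ⊛ geom a) ⊛ qPow k
      ≈⟨ ⊛-congʳ (qPow k) (≈-sym (geomTail≈qPow⊛geom a 1≤a)) ⟩
    geomTail a ⊛ qPow k ∎

  geom-unfold : ∀ a k → 1 ≤ a → geom a ⊛ qPow k ≈ qPow k ⊕ (geom a ⊛ qPow (a + k))
  geom-unfold a k 1≤a = begin
    geom a ⊛ qPow k
      ≈⟨ solve 3 (λ y x z → y :* z := (y :* (con 1ℚ :+ :- x)) :* z :+ y :* (x :* z)) ≈-refl (geom a) (qPow a) (qPow k) ⟩
    ((geom a ⊛ (1s ⊝ qPow a)) ⊛ qPow k) ⊕ (geom a ⊛ (qPow a ⊛ qPow k))
      ≈⟨ ⊕-cong (⊛-congʳ (qPow k) (geom-inverse a 1≤a)) (⊛-congˡ (geom a) (≗⇒≈ (qPow-+ a k))) ⟩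
    (1s ⊛ qPow k) ⊕ (geom a ⊛ qPow (a + k))
      ≈⟨ ⊕-congʳ (geom a ⊛ qPow (a + k)) (≗⇒≈ (⊛-identityˡ (qPow k))) ⟩
    qPow k ⊕ (geom a ⊛ qPow (a + k)) ∎

  geometric-sum : ∀ a → 1 ≤ a → (e : ℕ → ℕ) → (∀ n → e (suc n) ≡ a + e n) → ∀ s → s ≤ suc N →
                  sumS N (λ n → when (s ≤ᵇ n) (qPow (e n))) ≈ geom a ⊛ qPow (e s)
  geometric-sum a 1≤a e e-suc s s≤1+N = telescope (qPow ∘ e) (λ n → geom a ⊛ qPow (e n)) s s≤1+N step tail
    where
    step : ∀ n → s ≤ n → qPow (e n) ≈ geom a ⊛ qPow (e n) ⊝ geom a ⊛ qPow (e (suc n))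
    step n _ rewrite e-suc n = begin
      qPow (e n)
        ≈⟨ solve 2 (λ x y → x := (x :+ y) :+ :- y) ≈-refl (qPow (e n)) (geom a ⊛ qPow (a + e n)) ⟩
      (qPow (e n) ⊕ (geom a ⊛ qPow (a + e n))) ⊝ geom a ⊛ qPow (a + e n)
        ≈⟨ ⊕-congʳ (negate (geom a ⊛ qPow (a + e n))) (≈-sym (geom-unfold a (e n) 1≤a)) ⟩
      geom a ⊛ qPow (e n) ⊝ geom a ⊛ qPow (a + e n) ∎
    e-grows : ∀ n → n ≤ e n
    e-grows zero    = z≤n
    e-grows (suc n) rewrite e-suc n = ℕ.≤-trans (s≤s (e-grows n)) (ℕ.+-monoˡ-≤ (e n) 1≤a)
    tail : geom a ⊛ qPow (e (suc N)) ≈ 0s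
    tail = order>N⇒≈0 (⊛-order (order-0 (geom a)) (qPow-order (e (suc N)))) (e-grows (suc N))

  geometric-sum-above : ∀ m → 1 ≤ m → ∀ R′ → R′ ≤ N →
    sumS N (λ R → when (R′ <ᵇ R) (qPow (R * m))) ≈ qPow (R′ * m) ⊛ geomTail m
  geometric-sum-above m 1≤m R′ R′≤N = begin
    sumS N (λ R → when (R′ <ᵇ R) (qPow (R * m)))
      ≈⟨ geometric-sum m 1≤m (_* m) (λ _ → refl) (suc R′) (s≤s R′≤N) ⟩
    geom m ⊛ qPow (m + R′ * m)
      ≈⟨ geom⊛qPow-+ m (R′ * m) 1≤m ⟩
    geomTail m ⊛ qPow (R′ * m)
      ≈⟨ ≗⇒≈ (⊛-comm (geomTail m) (qPow (R′ * m))) ⟩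
    qPow (R′ * m) ⊛ geomTail m ∎

  -- Both sides equal Σ_{R > R′, n ≥ s} q^{R(n+m)}.
  geometric-double-sum : ∀ m → 1 ≤ m → ∀ R′ → R′ ≤ N → ∀ s → s ≤ suc N →
    sumS N (λ n → when (s ≤ᵇ n) (qPow (R′ * (n + m)) ⊛ geomTail (n + m)))
      ≈ sumS N (λ R → when (R′ <ᵇ R) (geom R ⊛ qPow (R * (s + m))))
  geometric-double-sum m 1≤m R′ R′≤N s s≤1+N = telescope W U s s≤1+N (λ n _ → peel n) tail
    where
    W P U : ℕ → Series
    W n = qPow (R′ * (n + m)) ⊛ geomTail (n + m)
    P n = sumS N (λ R → when (R′ <ᵇ R) (qPow (R * (n + m))))
    U n = sumS N (λ R → when (R′ <ᵇ R) (geom R ⊛ qPow (R * (n + m))))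
    split : ∀ R k → when (R′ <ᵇ R) (geom R ⊛ qPow (R * k))
                    ≈ when (R′ <ᵇ R) (qPow (R * k)) ⊕ when (R′ <ᵇ R) (geom R ⊛ qPow (R * suc k))
    split zero    k = solve 0 (con 0ℚ := con 0ℚ :+ con 0ℚ) ≈-refl
    split (suc R) k rewrite ℕ.*-suc (suc R) k =
      when-⊕ (R′ <ᵇ suc R) (geom-unfold (suc R) (suc R * k) (s≤s z≤n))
    peel : ∀ n → W n ≈ U n ⊝ U (suc n)
    peel n = begin
      W n
        ≈⟨ ≈-sym (geometric-sum-above (n + m) (ℕ.≤-trans 1≤m (ℕ.m≤n+m m n)) R′ R′≤N) ⟩
      P n
        ≈⟨ solve 2 (λ x y → x := (x :+ y) :+ :- y) ≈-refl (P n) (U (suc n)) ⟩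
      (P n ⊕ U (suc n)) ⊝ U (suc n)
        ≈⟨ ⊕-congʳ (negate (U (suc n))) (≈-sym (≈-trans (sumS-cong N (λ R _ → split R (n + m))) (sumS-⊕ N _ _))) ⟩
      U n ⊝ U (suc n) ∎
    tail : U (suc N) ≈ 0s
    tail = sumS-zero N _ vanish
      where
      vanish : ∀ R → R ≤ N → when (R′ <ᵇ R) (geom R ⊛ qPow (R * (suc N + m))) ≈ 0s
      vanish zero    _ = ≈-refl
      vanish (suc R) _ = when-zero (R′ <ᵇ suc R)
        (order>N⇒≈0 (⊛-order (order-0 (geom (suc R))) (qPow-order (suc R * (suc N + m))))
                    (ℕ.≤-trans (ℕ.m≤m+n (suc N) m) (ℕ.m≤m+n (suc N + m) (R * (suc N + m)))))

  -- The kernel q^(RT) (q;q)_R (q;q)_T / (q;q)_(R+T)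

  qPoch : ℕ → Series
  qPoch zero    = 1s
  qPoch (suc n) = qPoch n ⊛ (1s ⊝ qPow (suc n))

  qPochInv : ℕ → Series
  qPochInv zero    = 1s
  qPochInv (suc n) = qPochInv n ⊛ geom (suc n)

  qPoch-inverse : ∀ n → qPoch n ⊛ qPochInv n ≈ 1s
  qPoch-inverse zero    = solve 0 (con 1ℚ :* con 1ℚ := con 1ℚ) ≈-refl
  qPoch-inverse (suc n) = begin
    (qPoch n ⊛ (1s ⊝ qPow (suc n))) ⊛ (qPochInv n ⊛ geom (suc n))
      ≈⟨ solve 4 (λ p x i v → (p :* (con 1ℚ :+ :- x)) :* (i :* v) := (p :* i) :* (v :* (con 1ℚ :+ :- x))) ≈-refl
               (qPoch n) (qPow (suc n)) (qPochInv n) (geom (suc n)) ⟩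
    (qPoch n ⊛ qPochInv n) ⊛ (geom (suc n) ⊛ (1s ⊝ qPow (suc n)))
      ≈⟨ ⊛-cong (qPoch-inverse n) (geom-inverse (suc n) (s≤s z≤n)) ⟩
    1s ⊛ 1s
      ≈⟨ solve 0 (con 1ℚ :* con 1ℚ := con 1ℚ) ≈-refl ⟩
    1s ∎

  kernel : ℕ → ℕ → Series
  kernel R T = qPow (R * T) ⊛ (qPoch R ⊛ (qPoch T ⊛ qPochInv (R + T)))

  kernel-zeroˡ : ∀ T → kernel 0 T ≈ 1s
  kernel-zeroˡ T = begin
    qPow 0 ⊛ (1s ⊛ (qPoch T ⊛ qPochInv T))
      ≈⟨ ⊛-cong (≗⇒≈ qPow-zero) (⊛-congˡ 1s (qPoch-inverse T)) ⟩
    1s ⊛ (1s ⊛ 1s)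
      ≈⟨ solve 0 (con 1ℚ :* (con 1ℚ :* con 1ℚ) := con 1ℚ) ≈-refl ⟩
    1s ∎

  kernel-sym : ∀ R T → kernel R T ≈ kernel T R
  kernel-sym R T rewrite ℕ.*-comm R T | ℕ.+-comm R T =
    solve 4 (λ m p t i → m :* (p :* (t :* i)) := m :* (t :* (p :* i))) ≈-refl
          (qPow (T * R)) (qPoch R) (qPoch T) (qPochInv (T + R))

  kernel-order : ∀ R T → OrderAtLeast (R * T) (kernel R T)
  kernel-order R T = subst (λ p → OrderAtLeast p (kernel R T)) (ℕ.+-identityʳ (R * T))
    (⊛-order (qPow-order (R * T)) (order-0 (qPoch R ⊛ (qPoch T ⊛ qPochInv (R + T)))))

  kernel-suc : ∀ R T →
    kernel (suc R) T ≈ qPow T ⊛ ((1s ⊝ qPow (suc R)) ⊛ (geom (suc (R + T)) ⊛ kernel R T))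
  kernel-suc R T = begin
    qPow (T + R * T) ⊛ rest
      ≈⟨ ⊛-congʳ rest (≈-sym (≗⇒≈ (qPow-+ T (R * T)))) ⟩
    (qPow T ⊛ qPow (R * T)) ⊛ rest
      ≈⟨ solve 7 (λ a b p z t i v → (a :* b) :* ((p :* (con 1ℚ :+ :- z)) :* (t :* (i :* v)))
                                  := a :* ((con 1ℚ :+ :- z) :* (v :* (b :* (p :* (t :* i)))))) ≈-refl
               (qPow T) (qPow (R * T)) (qPoch R) (qPow (suc R)) (qPoch T) (qPochInv (R + T)) (geom (suc (R + T))) ⟩
    qPow T ⊛ ((1s ⊝ qPow (suc R)) ⊛ (geom (suc (R + T)) ⊛ kernel R T)) ∎
    where
    rest : Series
    rest = (qPoch R ⊛ (1s ⊝ qPow (suc R))) ⊛ (qPoch T ⊛ (qPochInv (R + T) ⊛ geom (suc (R + T))))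

  geom-kernel-factor : ∀ R T → 1 ≤ T →
    geom T ⊛ (1s ⊝ qPow T ⊛ ((1s ⊝ qPow (suc R)) ⊛ geom (suc (R + T)))) ≈ geom (suc (R + T))
  geom-kernel-factor R T 1≤T = begin
    u ⊛ (1s ⊝ x ⊛ ((1s ⊝ z) ⊛ v))
      ≈⟨ solve 4 (λ u x z v → u :* (con 1ℚ :+ :- (x :* ((con 1ℚ :+ :- z) :* v)))
                           := (u :* (con 1ℚ :+ :- x)) :* v :+ u :* (con 1ℚ :+ :- (v :* (con 1ℚ :+ :- (x :* z)))))
               ≈-refl u x z v ⟩
    ((u ⊛ (1s ⊝ x)) ⊛ v) ⊕ (u ⊛ (1s ⊝ v ⊛ (1s ⊝ x ⊛ z)))
      ≈⟨ ⊕-cong (⊛-congʳ v (geom-inverse T 1≤T)) (⊛-congˡ u (⊕-congˡ 1s (negate-cong v[1-xz]≈1))) ⟩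
    (1s ⊛ v) ⊕ (u ⊛ (1s ⊝ 1s))
      ≈⟨ solve 2 (λ u v → con 1ℚ :* v :+ u :* (con 1ℚ :+ :- con 1ℚ) := v) ≈-refl u v ⟩
    v ∎
    where
    x z u v : Series
    x = qPow T
    z = qPow (suc R)
    u = geom T
    v = geom (suc (R + T))
    xz≈q^[1+R+T] : x ⊛ z ≈ qPow (suc (R + T))
    xz≈q^[1+R+T] = ≗⇒≈ λ i → trans (qPow-+ T (suc R) i)
                                    (cong (λ k → qPow k i) (trans (ℕ.+-suc T R) (cong suc (ℕ.+-comm T R))))
    v[1-xz]≈1 : v ⊛ (1s ⊝ x ⊛ z) ≈ 1s
    v[1-xz]≈1 = ≈-trans (⊛-congˡ v (⊕-congˡ 1s (negate-cong xz≈q^[1+R+T]))) (geom-inverse (suc (R + T)) (s≤s z≤n))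

  kernel-recurrence : ∀ R T → 1 ≤ T →
    geom (suc R) ⊛ kernel (suc R) T ≈ geomTail T ⊛ kernel R T ⊝ geomTail T ⊛ kernel (suc R) T
  kernel-recurrence R T 1≤T = begin
    w ⊛ kernel (suc R) T
      ≈⟨ ⊛-congˡ w (kernel-suc R T) ⟩
    w ⊛ (x ⊛ ((1s ⊝ z) ⊛ (v ⊛ c)))
      ≈⟨ solve 5 (λ w x z v c → w :* (x :* ((con 1ℚ :+ :- z) :* (v :* c)))
                             := (w :* (con 1ℚ :+ :- z)) :* (x :* (v :* c))) ≈-refl w x z v c ⟩
    (w ⊛ (1s ⊝ z)) ⊛ (x ⊛ (v ⊛ c))
      ≈⟨ ⊛-congʳ (x ⊛ (v ⊛ c)) (geom-inverse (suc R) (s≤s z≤n)) ⟩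
    1s ⊛ (x ⊛ (v ⊛ c))
      ≈⟨ solve 3 (λ x v c → con 1ℚ :* (x :* (v :* c)) := x :* (c :* v)) ≈-refl x v c ⟩
    x ⊛ (c ⊛ v)
      ≈⟨ ⊛-congˡ x (⊛-congˡ c (≈-sym (geom-kernel-factor R T 1≤T))) ⟩
    x ⊛ (c ⊛ (u ⊛ (1s ⊝ x ⊛ ((1s ⊝ z) ⊛ v))))
      ≈⟨ solve 5 (λ x c u z v → x :* (c :* (u :* (con 1ℚ :+ :- (x :* ((con 1ℚ :+ :- z) :* v)))))
                             := (x :* u) :* c :+ :- ((x :* u) :* (x :* ((con 1ℚ :+ :- z) :* (v :* c))))) ≈-refl x c u z v ⟩
    (x ⊛ u) ⊛ c ⊝ (x ⊛ u) ⊛ (x ⊛ ((1s ⊝ z) ⊛ (v ⊛ c)))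
      ≈⟨ ⊕-cong (⊛-congʳ c (≈-sym g≈xu)) (negate-cong (⊛-cong (≈-sym g≈xu) (≈-sym (kernel-suc R T)))) ⟩
    geomTail T ⊛ c ⊝ geomTail T ⊛ kernel (suc R) T ∎
    where
    x z u v w c : Series
    x = qPow T
    z = qPow (suc R)
    u = geom T
    v = geom (suc (R + T))
    w = geom (suc R)
    c = kernel R T
    g≈xu : geomTail T ≈ x ⊛ u
    g≈xu = geomTail≈qPow⊛geom T 1≤T

  kernel-tail-sum : ∀ T → 1 ≤ T → ∀ R′ → R′ ≤ N →
    sumS N (λ R → when (R′ <ᵇ R) (geom R ⊛ kernel R T)) ≈ geomTail T ⊛ kernel R′ T
  kernel-tail-sum T@(suc _) 1≤T R′ R′≤N =
    telescope (λ R → geom R ⊛ kernel R T) (λ R → geomTail T ⊛ kernel (pred R) T) (suc R′) (s≤s R′≤N) step tail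
    where
    step : ∀ R → suc R′ ≤ R → geom R ⊛ kernel R T ≈ geomTail T ⊛ kernel (pred R) T ⊝ geomTail T ⊛ kernel R T
    step (suc R) _ = kernel-recurrence R T 1≤T
    tail : geomTail T ⊛ kernel N T ≈ 0s
    tail = order>N⇒≈0 (⊛-order (geomTail-order T) (kernel-order N T))
                      (ℕ.≤-<-trans (ℕ.m≤m*n N T) (ℕ.m<n+m (N * T) 1≤T))

  weighted-kernel-tail-sum : ∀ a (b : ℕ → Series) → b 0 ≈ 0s → ∀ T R′ → R′ ≤ N →
    sumS N (λ R → when (R′ <ᵇ R) (a ⊛ (geom R ⊛ (kernel R T ⊛ b T)))) ≈ a ⊛ (kernel R′ T ⊛ (b T ⊛ geomTail T))
  weighted-kernel-tail-sum a b b0≈0 zero R′ _ = begin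
    sumS N (λ R → when (R′ <ᵇ R) (a ⊛ (geom R ⊛ (kernel R 0 ⊛ b 0))))
      ≈⟨ sumS-zero N _ (λ R _ → when-zero (R′ <ᵇ R) (termVanishes R)) ⟩
    0s
      ≈⟨ ≈-sym rhsVanishes ⟩
    a ⊛ (kernel R′ 0 ⊛ (b 0 ⊛ geomTail 0)) ∎
    where
    termVanishes : ∀ R → a ⊛ (geom R ⊛ (kernel R 0 ⊛ b 0)) ≈ 0s
    termVanishes R = ≈-trans (⊛-congˡ a (⊛-congˡ (geom R) (⊛-congˡ (kernel R 0) b0≈0)))
                             (solve 3 (λ x g c → x :* (g :* (c :* con 0ℚ)) := con 0ℚ) ≈-refl a (geom R) (kernel R 0))
    rhsVanishes : a ⊛ (kernel R′ 0 ⊛ (b 0 ⊛ geomTail 0)) ≈ 0s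
    rhsVanishes = ≈-trans (⊛-congˡ a (⊛-congˡ (kernel R′ 0) (⊛-congʳ (geomTail 0) b0≈0)))
                          (solve 3 (λ x c g → x :* (c :* (con 0ℚ :* g)) := con 0ℚ) ≈-refl a (kernel R′ 0) (geomTail 0))
  weighted-kernel-tail-sum a b _ T@(suc _) R′ R′≤N = begin
    sumS N (λ R → when (R′ <ᵇ R) (a ⊛ (geom R ⊛ (kernel R T ⊛ b T))))
      ≈⟨ sumS-cong N (λ R _ → when-cong (R′ <ᵇ R)
           (solve 4 (λ a g c b → a :* (g :* (c :* b)) := a :* ((g :* c) :* b)) ≈-refl a (geom R) (kernel R T) (b T))) ⟩
    sumS N (λ R → when (R′ <ᵇ R) (a ⊛ ((geom R ⊛ kernel R T) ⊛ b T)))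
      ≈⟨ guarded-sandwich N (R′ <ᵇ_) a (λ R → geom R ⊛ kernel R T) (b T) ⟩
    a ⊛ (sumS N (λ R → when (R′ <ᵇ R) (geom R ⊛ kernel R T)) ⊛ b T)
      ≈⟨ ⊛-congˡ a (⊛-congʳ (b T) (kernel-tail-sum T (s≤s z≤n) R′ R′≤N)) ⟩
    a ⊛ ((geomTail T ⊛ kernel R′ T) ⊛ b T)
      ≈⟨ solve 4 (λ a g c b → a :* ((g :* c) :* b) := a :* (c :* (b :* g))) ≈-refl a (geomTail T) (kernel R′ T) (b T) ⟩
    a ⊛ (kernel R′ T ⊛ (b T ⊛ geomTail T)) ∎

  chain : List Kind → ℕ → Series
  chain []      R = δ₀ R
  chain (X ∷ u) R = chain u R ⊛ geomTail R
  chain (Y ∷ u) R = sumS N (λ R′ → when (R′ <ᵇ R) (chain u R′)) ⊛ geom R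

  chain-at-0 : ∀ k u → chain (k ∷ u) 0 ≈ 0s
  chain-at-0 X u = begin
    chain u 0 ⊛ geomTail 0
      ≈⟨ ⊛-congˡ (chain u 0) (≗⇒≈ (λ i → trans (geomTail-zero i) (sym (0s-coeff i)))) ⟩
    chain u 0 ⊛ 0s
      ≈⟨ solve 1 (λ a → a :* con 0ℚ := con 0ℚ) ≈-refl (chain u 0) ⟩
    0s ∎
  chain-at-0 Y u = begin
    sumS N (λ R′ → when (R′ <ᵇ 0) (chain u R′)) ⊛ geom 0
      ≈⟨ ⊛-congʳ (geom 0) (sumS-zero N _ (λ _ _ → ≈-refl)) ⟩
    0s ⊛ geom 0
      ≈⟨ solve 1 (λ a → con 0ℚ :* a := con 0ℚ) ≈-refl (geom 0) ⟩
    0s ∎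

  chain-Y-⊛ : ∀ u R x → chain (Y ∷ u) R ⊛ x ≈ sumS N (λ R′ → when (R′ <ᵇ R) (chain u R′ ⊛ (geom R ⊛ x)))
  chain-Y-⊛ u R x = ≈-trans (solve 3 (λ s g x → (s :* g) :* x := s :* (g :* x)) ≈-refl (before R) (geom R) x)
                            (guarded-⊛ N (_<ᵇ R) (chain u) (geom R ⊛ x))
    where
    before : ℕ → Series
    before R = sumS N (λ R′ → when (R′ <ᵇ R) (chain u R′))

  module Walk (Z : List Kind → List Kind → Series)
              (moveY : ∀ u v → Z u (Y ∷ v ++ [ X ]) ≈ Z (Y ∷ u) (v ++ [ X ]))
              (moveX : ∀ k u v → Z (k ∷ u) (X ∷ v) ≈ Z (X ∷ k ∷ u) v) where

    walk : ∀ v k u → Z (k ∷ u) (v ++ [ X ]) ≈ Z ((v ++ [ X ]) ʳ++ (k ∷ u)) []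
    walk []      k u = moveX k u []
    walk (X ∷ v) k u = ≈-trans (moveX k u (v ++ [ X ])) (walk v X (k ∷ u))
    walk (Y ∷ v) k u = ≈-trans (moveY (k ∷ u) v) (walk v Y (k ∷ u))

    walk-all : ∀ v → Z [] (Y ∷ v ++ [ X ]) ≈ Z (reverse (Y ∷ v ++ [ X ])) []
    walk-all v = ≈-trans (moveY [] v) (walk v Y [])

  bridge₂ : List Kind → List Kind → Series
  bridge₂ u v = sumS N (λ R → sumS N (λ T → chain u R ⊛ (kernel R T ⊛ chain (map swapKind v) T)))

  bridge₂-sym : ∀ u v → bridge₂ u v ≈ bridge₂ (map swapKind v) (map swapKind u)
  bridge₂-sym u v = begin
    bridge₂ u v
      ≈⟨ sumS-swap N N _ ⟩
    sumS N (λ T → sumS N (λ R → chain u R ⊛ (kernel R T ⊛ chain (map swapKind v) T)))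
      ≈⟨ sumS-cong N (λ T _ → sumS-cong N (λ R _ → mirror R T)) ⟩
    bridge₂ (map swapKind v) (map swapKind u) ∎
    where
    mirror : ∀ R T → chain u R ⊛ (kernel R T ⊛ chain (map swapKind v) T)
                   ≈ chain (map swapKind v) T ⊛ (kernel T R ⊛ chain (map swapKind (map swapKind u)) R)
    mirror R T rewrite map-swapKind-involutive u = begin
      chain u R ⊛ (kernel R T ⊛ chain (map swapKind v) T)
        ≈⟨ ⊛-congˡ (chain u R) (⊛-congʳ (chain (map swapKind v) T) (kernel-sym R T)) ⟩
      chain u R ⊛ (kernel T R ⊛ chain (map swapKind v) T)
        ≈⟨ solve 3 (λ a k b → a :* (k :* b) := b :* (k :* a)) ≈-refl
                 (chain u R) (kernel T R) (chain (map swapKind v) T) ⟩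
      chain (map swapKind v) T ⊛ (kernel T R ⊛ chain u R) ∎

  bridge₂-right : ∀ u → bridge₂ u [] ≈ sumS N (chain u)
  bridge₂-right u = sumS-cong N λ R _ → begin
    sumS N (λ T → chain u R ⊛ (kernel R T ⊛ δ₀ T))
      ≈⟨ sumS-cong N (λ T _ → solve 3 (λ a k d → a :* (k :* d) := d :* (a :* k)) ≈-refl
                                      (chain u R) (kernel R T) (δ₀ T)) ⟩
    sumS N (λ T → δ₀ T ⊛ (chain u R ⊛ kernel R T))
      ≈⟨ sumS-δ₀ N (λ T → chain u R ⊛ kernel R T) ⟩
    chain u R ⊛ kernel R 0
      ≈⟨ ⊛-congˡ (chain u R) (≈-trans (kernel-sym R 0) (kernel-zeroˡ R)) ⟩
    chain u R ⊛ 1s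
      ≈⟨ solve 1 (λ a → a :* con 1ℚ := a) ≈-refl (chain u R) ⟩
    chain u R ∎

  bridge₂-left : ∀ v → bridge₂ [] v ≈ sumS N (chain (map swapKind v))
  bridge₂-left v = ≈-trans (bridge₂-sym [] v) (bridge₂-right (map swapKind v))

  bridge₂-moveY : ∀ u k v → bridge₂ u (Y ∷ k ∷ v) ≈ bridge₂ (Y ∷ u) (k ∷ v)
  bridge₂-moveY u k v = ≈-sym (begin
    sumS N (λ R → sumS N (λ T → chain (Y ∷ u) R ⊛ (kernel R T ⊛ b T)))
      ≈⟨ sumS-cong N (λ R _ → sumS-cong N (λ T _ → chain-Y-⊛ u R (kernel R T ⊛ b T))) ⟩
    sumS N (λ R → sumS N (λ T → sumS N (λ R′ → term R T R′)))
      ≈⟨ sumS-swap N N _ ⟩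
    sumS N (λ T → sumS N (λ R → sumS N (λ R′ → term R T R′)))
      ≈⟨ sumS-cong N (λ T _ → sumS-swap N N (λ R R′ → term R T R′)) ⟩
    sumS N (λ T → sumS N (λ R′ → sumS N (λ R → term R T R′)))
      ≈⟨ sumS-cong N (λ T _ → sumS-cong N (λ R′ R′≤N → weighted-kernel-tail-sum (a R′) b b0≈0 T R′ R′≤N)) ⟩
    sumS N (λ T → sumS N (λ R′ → a R′ ⊛ (kernel R′ T ⊛ (b T ⊛ geomTail T))))
      ≈⟨ sumS-swap N N _ ⟩
    bridge₂ u (Y ∷ k ∷ v) ∎)
    where
    a b : ℕ → Series
    a = chain u
    b = chain (map swapKind (k ∷ v))
    b0≈0 : b 0 ≈ 0s
    b0≈0 = chain-at-0 (swapKind k) (map swapKind v)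
    term : ℕ → ℕ → ℕ → Series
    term R T R′ = when (R′ <ᵇ R) (a R′ ⊛ (geom R ⊛ (kernel R T ⊛ b T)))

  bridge₂-moveX : ∀ k u v → bridge₂ (k ∷ u) (X ∷ v) ≈ bridge₂ (X ∷ k ∷ u) v
  bridge₂-moveX k u v = begin
    bridge₂ (k ∷ u) (X ∷ v)
      ≈⟨ bridge₂-sym (k ∷ u) (X ∷ v) ⟩
    bridge₂ (Y ∷ map swapKind v) (swapKind k ∷ map swapKind u)
      ≈⟨ ≈-sym (bridge₂-moveY (map swapKind v) (swapKind k) (map swapKind u)) ⟩
    bridge₂ (map swapKind v) (Y ∷ swapKind k ∷ map swapKind u)
      ≈⟨ ≈-sym (bridge₂-sym (X ∷ k ∷ u) v) ⟩
    bridge₂ (X ∷ k ∷ u) v ∎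

  chainSum-reverse≈swap : ∀ v →
    sumS N (chain (reverse (Y ∷ v ++ [ X ]))) ≈ sumS N (chain (map swapKind (Y ∷ v ++ [ X ])))
  chainSum-reverse≈swap v = begin
    sumS N (chain (reverse (Y ∷ v ++ [ X ])))   ≈⟨ ≈-sym (bridge₂-right (reverse (Y ∷ v ++ [ X ]))) ⟩
    bridge₂ (reverse (Y ∷ v ++ [ X ])) []       ≈⟨ ≈-sym (walk-all v) ⟩
    bridge₂ [] (Y ∷ v ++ [ X ])                 ≈⟨ bridge₂-left (Y ∷ v ++ [ X ]) ⟩
    sumS N (chain (map swapKind (Y ∷ v ++ [ X ]))) ∎
    where
    moveY : ∀ u v → bridge₂ u (Y ∷ v ++ [ X ]) ≈ bridge₂ (Y ∷ u) (v ++ [ X ])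
    moveY u []      = bridge₂-moveY u X []
    moveY u (k ∷ v) = bridge₂-moveY u k (v ++ [ X ])
    open Walk bridge₂ moveY bridge₂-moveX

  partialK-guarded : ∀ v n → n ≤ N → partialK n v ≈ sumS N (λ n′ → when (n′ ≤ᵇ n) (partialTerm v n′))
  partialK-guarded (k ∷ v) n n≤N = sumS-extend n n≤N (partialTerm (k ∷ v))
  partialK-guarded []      n _   = ≈-sym (≈-trans (sumS-cong N δ₀-guarded) (sumS-δ₀ N (λ _ → 1s)))
    where
    δ₀-guarded : ∀ n′ → n′ ≤ N → when (n′ ≤ᵇ n) (δ₀ n′) ≈ δ₀ n′ ⊛ 1s
    δ₀-guarded zero     _ = solve 0 (con 1ℚ := con 1ℚ :* con 1ℚ) ≈-refl
    δ₀-guarded (suc n′) _ = ≈-trans (when-zero (suc n′ ≤ᵇ n) ≈-refl) (solve 0 (con 0ℚ := con 0ℚ :* con 1ℚ) ≈-refl)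

  partialK-full : ∀ v → partialK N v ≈ sumS N (partialTerm v)
  partialK-full v = ≈-trans (partialK-guarded v N ℕ.≤-refl)
                            (sumS-cong N (λ n n≤N → when-true (partialTerm v n) (≤ᵇ-true n≤N)))

  twisted : List Kind → ℕ → Series
  twisted v R = sumS N (λ n → qPow (R * (n + countX v)) ⊛ partialTerm v n)

  twisted-X : ∀ v R → 1 ≤ R → twisted (X ∷ v) R ≈ geomTail R ⊛ twisted v R
  twisted-X v R 1≤R = begin
    sumS N (λ n → a n ⊛ (1s ⊛ partialK n v))
      ≈⟨ sumS-cong N (λ n n≤N → ⊛-congˡ (a n) (unfold n n≤N)) ⟩
    sumS N (λ n → a n ⊛ sumS N (λ n′ → when (n′ ≤ᵇ n) (E n′)))
      ≈⟨ triangle-swap a E ⟩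
    sumS N (λ n′ → sumS N (λ n → when (n′ ≤ᵇ n) (a n)) ⊛ E n′)
      ≈⟨ sumS-cong N (λ n′ n′≤N → ⊛-congʳ (E n′) (sum-a n′ n′≤N)) ⟩
    sumS N (λ n′ → (geomTail R ⊛ t n′) ⊛ E n′)
      ≈⟨ sumS-cong N (λ n′ _ → solve 3 (λ g x y → (g :* x) :* y := g :* (x :* y)) ≈-refl (geomTail R) (t n′) (E n′)) ⟩
    sumS N (λ n′ → geomTail R ⊛ (t n′ ⊛ E n′))
      ≈⟨ ≈-sym (⊛-sumS N (geomTail R) (λ n′ → t n′ ⊛ E n′)) ⟩
    geomTail R ⊛ twisted v R ∎
    where
    b : ℕ
    b = countX v
    E a t : ℕ → Series
    E = partialTerm v
    a n = qPow (R * (n + suc b))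
    t n = qPow (R * (n + b))
    unfold : ∀ n → n ≤ N → 1s ⊛ partialK n v ≈ sumS N (λ n′ → when (n′ ≤ᵇ n) (E n′))
    unfold n n≤N = ≈-trans (≗⇒≈ (⊛-identityˡ (partialK n v))) (partialK-guarded v n n≤N)
    sum-a : ∀ n′ → n′ ≤ N → sumS N (λ n → when (n′ ≤ᵇ n) (a n)) ≈ geomTail R ⊛ t n′
    sum-a n′ n′≤N =
      ≈-trans (geometric-sum R 1≤R (λ n → R * (n + suc b)) (λ n → ℕ.*-suc R (n + suc b)) n′ (ℕ.m≤n⇒m≤1+n n′≤N))
              shift
      where
      shift : geom R ⊛ qPow (R * (n′ + suc b)) ≈ geomTail R ⊛ t n′
      shift rewrite ℕ.+-suc n′ b | ℕ.*-suc R (n′ + b) = geom⊛qPow-+ R (R * (n′ + b)) 1≤R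

  twisted-Y : ∀ v → 1 ≤ countX v → ∀ R′ → R′ ≤ N →
    sumS N (λ R → when (R′ <ᵇ R) (geom R ⊛ twisted v R)) ≈ twisted (Y ∷ v) R′
  twisted-Y v 1≤b R′ R′≤N = begin
    sumS N (λ R → when (R′ <ᵇ R) (geom R ⊛ twisted v R))
      ≈⟨ sumS-cong N (λ R _ → distribute R) ⟩
    sumS N (λ R → sumS N (λ n′ → when (R′ <ᵇ R) (geom R ⊛ (t R n′ ⊛ E n′))))
      ≈⟨ sumS-swap N N _ ⟩
    sumS N (λ n′ → sumS N (λ R → when (R′ <ᵇ R) (geom R ⊛ (t R n′ ⊛ E n′))))
      ≈⟨ sumS-cong N (λ n′ _ → regroup n′) ⟩
    sumS N (λ n′ → sumS N (λ R → when (R′ <ᵇ R) (geom R ⊛ t R n′)) ⊛ E n′)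
      ≈⟨ sumS-cong N (λ n′ n′≤N → ⊛-congʳ (E n′) (≈-sym (geometric-double-sum b 1≤b R′ R′≤N n′ (ℕ.m≤n⇒m≤1+n n′≤N)))) ⟩
    sumS N (λ n′ → sumS N (λ n → when (n′ ≤ᵇ n) (W n)) ⊛ E n′)
      ≈⟨ ≈-sym (triangle-swap W E) ⟩
    sumS N (λ n → W n ⊛ sumS N (λ n′ → when (n′ ≤ᵇ n) (E n′)))
      ≈⟨ sumS-cong N (λ n n≤N → fold n n≤N) ⟩
    twisted (Y ∷ v) R′ ∎
    where
    b : ℕ
    b = countX v
    E W : ℕ → Series
    E = partialTerm v
    W n = qPow (R′ * (n + b)) ⊛ geomTail (n + b)
    t : ℕ → ℕ → Series
    t R n = qPow (R * (n + b))
    distribute : ∀ R → when (R′ <ᵇ R) (geom R ⊛ twisted v R)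
                       ≈ sumS N (λ n′ → when (R′ <ᵇ R) (geom R ⊛ (t R n′ ⊛ E n′)))
    distribute R = ≈-trans (when-cong (R′ <ᵇ R) (⊛-sumS N (geom R) (λ n′ → t R n′ ⊛ E n′)))
                           (when-sumS (R′ <ᵇ R) N (λ n′ → geom R ⊛ (t R n′ ⊛ E n′)))
    regroup : ∀ n′ → sumS N (λ R → when (R′ <ᵇ R) (geom R ⊛ (t R n′ ⊛ E n′)))
                     ≈ sumS N (λ R → when (R′ <ᵇ R) (geom R ⊛ t R n′)) ⊛ E n′
    regroup n′ = begin
      sumS N (λ R → when (R′ <ᵇ R) (geom R ⊛ (t R n′ ⊛ E n′)))
        ≈⟨ sumS-cong N (λ R _ → when-cong (R′ <ᵇ R)
             (solve 3 (λ g x y → g :* (x :* y) := (g :* x) :* y) ≈-refl (geom R) (t R n′) (E n′))) ⟩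
      sumS N (λ R → when (R′ <ᵇ R) ((geom R ⊛ t R n′) ⊛ E n′))
        ≈⟨ ≈-sym (guarded-⊛ N (R′ <ᵇ_) (λ R → geom R ⊛ t R n′) (E n′)) ⟩
      sumS N (λ R → when (R′ <ᵇ R) (geom R ⊛ t R n′)) ⊛ E n′ ∎
    fold : ∀ n → n ≤ N → W n ⊛ sumS N (λ n′ → when (n′ ≤ᵇ n) (E n′))
                         ≈ qPow (R′ * (n + b)) ⊛ (geomTail (n + b) ⊛ partialK n v)
    fold n n≤N = ≈-trans (⊛-congˡ (W n) (≈-sym (partialK-guarded v n n≤N)))
                         (solve 3 (λ x g p → (x :* g) :* p := x :* (g :* p)) ≈-refl
                                (qPow (R′ * (n + b))) (geomTail (n + b)) (partialK n v))

  bridge₁ : List Kind → List Kind → Series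
  bridge₁ u v = sumS N (λ R → chain u R ⊛ twisted v R)

  bridge₁-left : ∀ v → bridge₁ [] v ≈ partialK N v
  bridge₁-left v = begin
    sumS N (λ R → δ₀ R ⊛ twisted v R)
      ≈⟨ sumS-δ₀ N (twisted v) ⟩
    sumS N (λ n → qPow 0 ⊛ partialTerm v n)
      ≈⟨ sumS-cong N (λ n _ → ≈-trans (⊛-congʳ (partialTerm v n) (≗⇒≈ qPow-zero)) (≗⇒≈ (⊛-identityˡ (partialTerm v n)))) ⟩
    sumS N (partialTerm v)
      ≈⟨ ≈-sym (partialK-full v) ⟩
    partialK N v ∎

  bridge₁-right : ∀ u → bridge₁ u [] ≈ sumS N (chain u)
  bridge₁-right u = sumS-cong N λ R _ → begin
    chain u R ⊛ sumS N (λ n → qPow (R * (n + 0)) ⊛ δ₀ n)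
      ≈⟨ ⊛-congˡ (chain u R) (sumS-cong N (λ n _ → ≗⇒≈ (⊛-comm (qPow (R * (n + 0))) (δ₀ n)))) ⟩
    chain u R ⊛ sumS N (λ n → δ₀ n ⊛ qPow (R * (n + 0)))
      ≈⟨ ⊛-congˡ (chain u R) (sumS-δ₀ N (λ n → qPow (R * (n + 0)))) ⟩
    chain u R ⊛ qPow (R * 0)
      ≈⟨ ⊛-congˡ (chain u R) (≗⇒≈ (λ i → trans (cong (λ k → qPow k i) (ℕ.*-zeroʳ R)) (qPow-zero i))) ⟩
    chain u R ⊛ 1s
      ≈⟨ solve 1 (λ a → a :* con 1ℚ := a) ≈-refl (chain u R) ⟩
    chain u R ∎

  bridge₁-moveX : ∀ k u v → bridge₁ (k ∷ u) (X ∷ v) ≈ bridge₁ (X ∷ k ∷ u) v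
  bridge₁-moveX k u v = sumS-cong N move
    where
    move : ∀ R → R ≤ N → chain (k ∷ u) R ⊛ twisted (X ∷ v) R ≈ (chain (k ∷ u) R ⊛ geomTail R) ⊛ twisted v R
    move zero _ = begin
      chain (k ∷ u) 0 ⊛ twisted (X ∷ v) 0
        ≈⟨ ⊛-congʳ (twisted (X ∷ v) 0) (chain-at-0 k u) ⟩
      0s ⊛ twisted (X ∷ v) 0
        ≈⟨ solve 3 (λ x g t → con 0ℚ :* x := (con 0ℚ :* g) :* t) ≈-refl (twisted (X ∷ v) 0) (geomTail 0) (twisted v 0) ⟩
      (0s ⊛ geomTail 0) ⊛ twisted v 0
        ≈⟨ ⊛-congʳ (twisted v 0) (⊛-congʳ (geomTail 0) (≈-sym (chain-at-0 k u))) ⟩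
      (chain (k ∷ u) 0 ⊛ geomTail 0) ⊛ twisted v 0 ∎
    move R@(suc _) _ = begin
      chain (k ∷ u) R ⊛ twisted (X ∷ v) R
        ≈⟨ ⊛-congˡ (chain (k ∷ u) R) (twisted-X v R (s≤s z≤n)) ⟩
      chain (k ∷ u) R ⊛ (geomTail R ⊛ twisted v R)
        ≈⟨ solve 3 (λ a g t → a :* (g :* t) := (a :* g) :* t) ≈-refl (chain (k ∷ u) R) (geomTail R) (twisted v R) ⟩
      (chain (k ∷ u) R ⊛ geomTail R) ⊛ twisted v R ∎

  bridge₁-moveY : ∀ u v → 1 ≤ countX v → bridge₁ u (Y ∷ v) ≈ bridge₁ (Y ∷ u) v
  bridge₁-moveY u v 1≤b = ≈-sym (begin
    sumS N (λ R → chain (Y ∷ u) R ⊛ twisted v R)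
      ≈⟨ sumS-cong N (λ R _ → chain-Y-⊛ u R (twisted v R)) ⟩
    sumS N (λ R → sumS N (λ R′ → when (R′ <ᵇ R) (chain u R′ ⊛ (geom R ⊛ twisted v R))))
      ≈⟨ sumS-swap N N _ ⟩
    sumS N (λ R′ → sumS N (λ R → when (R′ <ᵇ R) (chain u R′ ⊛ (geom R ⊛ twisted v R))))
      ≈⟨ sumS-cong N (λ R′ R′≤N → ≈-trans (≈-sym (⊛-guarded N (R′ <ᵇ_) (chain u R′) (λ R → geom R ⊛ twisted v R)))
                                           (⊛-congˡ (chain u R′) (twisted-Y v 1≤b R′ R′≤N))) ⟩
    bridge₁ u (Y ∷ v) ∎)

  partialK≈chainSum-reverse : ∀ v → partialK N (Y ∷ v ++ [ X ]) ≈ sumS N (chain (reverse (Y ∷ v ++ [ X ])))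
  partialK≈chainSum-reverse v = begin
    partialK N (Y ∷ v ++ [ X ])                   ≈⟨ ≈-sym (bridge₁-left (Y ∷ v ++ [ X ])) ⟩
    bridge₁ [] (Y ∷ v ++ [ X ])                   ≈⟨ walk-all v ⟩
    bridge₁ (reverse (Y ∷ v ++ [ X ])) []         ≈⟨ bridge₁-right (reverse (Y ∷ v ++ [ X ])) ⟩
    sumS N (chain (reverse (Y ∷ v ++ [ X ])))     ∎
    where
    open Walk bridge₁ (λ u v → bridge₁-moveY u (v ++ [ X ]) (countX-∷ʳ-X v)) bridge₁-moveX

  partialK-τK : ∀ v → partialK N (Y ∷ v ++ [ X ]) ≈ partialK N (Y ∷ τK v ++ [ X ])
  partialK-τK v = begin
    partialK N w                                 ≈⟨ partialK≈chainSum-reverse v ⟩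
    sumS N (chain (reverse w))                   ≈⟨ chainSum-reverse≈swap v ⟩
    sumS N (chain (map swapKind w))              ≡⟨ cong (sumS N ∘ chain) (sym (List.reverse-involutive (map swapKind w))) ⟩
    sumS N (chain (reverse (τK w)))              ≡⟨ cong (sumS N ∘ chain ∘ reverse) (τK-shape v) ⟩
    sumS N (chain (reverse (Y ∷ τK v ++ [ X ]))) ≈⟨ ≈-sym (partialK≈chainSum-reverse (τK v)) ⟩
    partialK N (Y ∷ τK v ++ [ X ])               ∎
    where
    w : List Kind
    w = Y ∷ v ++ [ X ]

  partialK-stable : ∀ v M → N ≤ M → partialK M (Y ∷ v) ≈ partialK N (Y ∷ v)
  partialK-stable v = sumS-beyond (λ n → geomTail (n + countX v) ⊛ partialK n v) beyond
    where
    beyond : ∀ n → N < n → geomTail (n + countX v) ⊛ partialK n v ≈ 0s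
    beyond n N<n = order>N⇒≈0 (⊛-order (geomTail-order (n + countX v)) (order-0 (partialK n v)))
                              (ℕ.<-≤-trans N<n (ℕ.≤-trans (ℕ.m≤m+n n (countX v)) (ℕ.m≤m+n (n + countX v) 0)))

  partialK-τK-coeff : ∀ v M → N ≤ M → partialK M (Y ∷ v ++ [ X ]) N ≡ partialK M (τK (Y ∷ v ++ [ X ])) N
  partialK-τK-coeff v M N≤M = coeff (begin
    partialK M (Y ∷ v ++ [ X ])                 ≈⟨ partialK-stable (v ++ [ X ]) M N≤M ⟩
    partialK N (Y ∷ v ++ [ X ])                 ≈⟨ partialK-τK v ⟩
    partialK N (Y ∷ τK v ++ [ X ])              ≈⟨ ≈-sym (partialK-stable (τK v ++ [ X ]) M N≤M) ⟩
    partialK M (Y ∷ τK v ++ [ X ])              ≡⟨ cong (partialK M) (sym (τK-shape v)) ⟩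
    partialK M (τK (Y ∷ v ++ [ X ]))            ∎) N ℕ.≤-refl

data KindOf : Letter → Kind → Set where
  AB : KindOf eAB X
  AC : KindOf eAC X
  BD : KindOf eBD Y
  CD : KindOf eCD Y

KindOf-τl : ∀ {l k} → KindOf l k → KindOf (τl l) (swapKind k)
KindOf-τl AB = CD
KindOf-τl AC = BD
KindOf-τl BD = AC
KindOf-τl CD = AB

KindsOf : Word → List Kind → Set
KindsOf = Pointwise KindOf

KindsOf-τ : ∀ {w v} → KindsOf w v → KindsOf (τ w) (τK v)
KindsOf-τ p = Pointwise.reverse⁺ (Pointwise.map⁺ τl swapKind (Pointwise.map KindOf-τl p))

HasBC : Word → Set
HasBC = Any (_≡ eBC)

HasBC-τ : ∀ {w} → HasBC w → HasBC (τ w)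
HasBC-τ bc = Any.reverse⁺ (Any.map⁺ (Any.map (cong τl) bc))

∷-hasBC-or-kinds : ∀ {l k w} → KindOf l k →
                   HasBC w ⊎ ∃[ v ] KindsOf w v → HasBC (l ∷ w) ⊎ ∃[ v ] KindsOf (l ∷ w) v
∷-hasBC-or-kinds _  (inj₁ bc)      = inj₁ (there bc)
∷-hasBC-or-kinds kl (inj₂ (v , p)) = inj₂ (_ ∷ v , kl ∷ p)

hasBC-or-kinds : ∀ w → NoAD w → HasBC w ⊎ ∃[ v ] KindsOf w v
hasBC-or-kinds []        _    = inj₂ ([] , [])
hasBC-or-kinds (eAB ∷ w) noAD = ∷-hasBC-or-kinds AB (hasBC-or-kinds w noAD)
hasBC-or-kinds (eAC ∷ w) noAD = ∷-hasBC-or-kinds AC (hasBC-or-kinds w noAD)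
hasBC-or-kinds (eBC ∷ w) _    = inj₁ (here refl)
hasBC-or-kinds (eBD ∷ w) noAD = ∷-hasBC-or-kinds BD (hasBC-or-kinds w noAD)
hasBC-or-kinds (eCD ∷ w) noAD = ∷-hasBC-or-kinds CD (hasBC-or-kinds w noAD)

partial-HasBC : ∀ {w} → HasBC w → ∀ M i → partial M w i ≡ 0ℚ
partial-HasBC {eBC ∷ w} (here refl) M i =
  sumTo-zero M _ (λ n _ → ⊛-zeroˡ (factor eBC n d) (partial n w) (factor-eBC n) i)
  where
  d : ℕ
  d = dCount (eBC ∷ w)
  factor-eBC : ∀ n i → factor eBC n d i ≡ 0ℚ
  factor-eBC n zero    = refl
  factor-eBC n (suc i) = refl
partial-HasBC {l ∷ w} (there bc) M i =
  sumTo-zero M _ (λ n _ → ⊛-zeroʳ (factor l n (dCount (l ∷ w))) (partial n w) (partial-HasBC bc n) i)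

0-negGeomTail : ∀ m → cst 0ℚ ⊖ negGeomTail m ≗ geomTail m
0-negGeomTail m zero = refl
0-negGeomTail m (suc i) with does (m ∣? suc i)
... | true  = refl
... | false = refl

factor-KindOf : ∀ {l k} → KindOf l k → ∀ n d → factor l n d ≗ kindFactor k n d
factor-KindOf AB n d = λ { zero → refl ; (suc i) → refl }
factor-KindOf AC n d = λ { zero → refl ; (suc i) → refl }
factor-KindOf BD n d = 0-negGeomTail (n + d)
factor-KindOf CD n d = 0-negGeomTail (n + d)

dCount-KindsOf : ∀ {w v} → KindsOf w v → dCount w ≡ countX v
dCount-KindsOf []       = refl
dCount-KindsOf (AB ∷ p) = cong suc (dCount-KindsOf p)
dCount-KindsOf (AC ∷ p) = cong suc (dCount-KindsOf p)
dCount-KindsOf (BD ∷ p) = dCount-KindsOf p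
dCount-KindsOf (CD ∷ p) = dCount-KindsOf p

partial-KindsOf : ∀ {w v} → KindsOf w v → ∀ M → partial M w ≗ partialK M v
partial-KindsOf []                           M i = refl
partial-KindsOf {l ∷ w} {k ∷ v} p@(kl ∷ ps) M i = sumTo-cong M λ n _ →
  ⊛-coeff-cong i (λ j _ → trans (factor-KindOf kl n (dCount (l ∷ w)) j)
                                 (cong (λ d → kindFactor k n d j) (dCount-KindsOf p)))
                 (λ j _ → partial-KindsOf ps n j)

ends-with-X : ∀ {l w k v} → NotEndBad (l ∷ w) → KindsOf (l ∷ w) (k ∷ v) → ∃[ mid ] k ∷ v ≡ mid ++ [ X ]
ends-with-X _   (AB ∷ [])         = [] , refl
ends-with-X _   (AC ∷ [])         = [] , refl
ends-with-X neb (BD ∷ [])         = ⊥-elim (neb tt)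
ends-with-X neb (CD ∷ [])         = ⊥-elim (neb tt)
ends-with-X {k = k} neb (_ ∷ p@(_ ∷ _)) with mid , eq ← ends-with-X neb p = k ∷ mid , cong (k ∷_) eq

admissible-shape : ∀ {w k v} → Admissible w → KindsOf w (k ∷ v) → ∃[ mid ] k ∷ v ≡ Y ∷ mid ++ [ X ]
admissible-shape (nbb , _)   (AB ∷ _)          = ⊥-elim (nbb tt)
admissible-shape (nbb , _)   (AC ∷ _)          = ⊥-elim (nbb tt)
admissible-shape (_   , neb) (BD ∷ [])         = ⊥-elim (neb tt)
admissible-shape (_   , neb) (CD ∷ [])         = ⊥-elim (neb tt)
admissible-shape (_   , neb) (BD ∷ p@(_ ∷ _)) with mid , eq ← ends-with-X neb p = mid , cong (Y ∷_) eq
admissible-shape (_   , neb) (CD ∷ p@(_ ∷ _)) with mid , eq ← ends-with-X neb p = mid , cong (Y ∷_) eq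

partial-τ : ∀ w → Admissible w → NoAD w → ∀ N M → N ≤ M → partial M w N ≡ partial M (τ w) N
partial-τ w adm noAD N M N≤M with hasBC-or-kinds w noAD
... | inj₁ bc        = trans (partial-HasBC bc M N) (sym (partial-HasBC (HasBC-τ bc) M N))
... | inj₂ (_ , [])  = refl
... | inj₂ (_ , p@(_ ∷ _)) with admissible-shape adm p
...   | mid , refl = begin
  partial M w N                       ≡⟨ partial-KindsOf p M N ⟩
  partialK M (Y ∷ mid ++ [ X ]) N      ≡⟨ UpToDegree.partialK-τK-coeff N mid M N≤M ⟩
  partialK M (τK (Y ∷ mid ++ [ X ])) N ≡⟨ sym (partial-KindsOf (KindsOf-τ p) M N) ⟩
  partial M (τ w) N                   ∎
  where open ≡-Reasoning

partialLin-τLin : ∀ x → All (λ p → Admissible (proj₂ p) × NoAD (proj₂ p)) x →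
                  ∀ N M → N ≤ M → partialLin M x N ≡ partialLin M (τLin x) N
partialLin-τLin []            []                   N M N≤M = refl
partialLin-τLin ((c , w) ∷ x) ((adm , noAD) ∷ hyps) N M N≤M =
  cong₂ _+q_ (cong (c *q_) (partial-τ w adm noAD N M N≤M)) (partialLin-τLin x hyps N M N≤M)

lemma4p5 : (x : LinComb) → All (λ p → Admissible (proj₂ p) × NoAD (proj₂ p)) x → fEq x (τLin x)
lemma4p5 x hyps N = N , partialLin-τLin x hyps N
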